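{- Let $m$ be a non-negative integer, $k_1,k_2$ positive integers, and $A,D$ two $k_1$-tuples of elements of $\mathbb{Z}/m\mathbb{Z}$. Put $W=C_{k_1}^{(k_2)}+(-1)^{k_2+1}I_{k_1}$ and $T=T_{k_1}^{(k_2)}$. Then the orbit of $S=\mathrm{IAP}(A,D)$ is $(k_1,k_2)$-interlaced doubly arithmetic if and only if the row vector $(A\mid D)$ satisfies $(A\mid D)\,\pi_m\!\begin{pmatrix} W^2 & 0_{k_1}\\ TW & W\end{pmatrix}=0$. Moreover, in that case the orbit equals $\mathrm{IDAP}(\mathbf{A},\mathbf{D}_1,\mathbf{D}_2)$ where, for each $i\in\{0,\dots,k_2-1\}$, the rows (indexed from $0$) of the $k_2\times k_1$ matrices $\mathbf{A},\mathbf{D}_1,\mathbf{D}_2$ are $$R_i(\mathbf{A})=(-1)^i\big(AC_{k_1}^{(i)}+DT_{k_1}^{(i)}\big),\quad R_i(\mathbf{D}_1)=(-1)^iDC_{k_1}^{(i)},\quad R_i(\mathbf{D}_2)=(-1)^{i+k_2}\big(AW+DT\big)C_{k_1}^{(i)}.$$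
   Context: $\mathbb{Z}/0\mathbb{Z}$ is identified with $\mathbb{Z}$; $\pi_m$ is reduction mod $m$. For $k$-tuples $A=(a_0,\dots,a_{k-1})$, $D=(d_0,\dots,d_{k-1})$, $\mathrm{IAP}(A,D)$ is the doubly infinite sequence $(u_j)_{j\in\mathbb{Z}}$ with $u_{qk+r}=a_r+qd_r$. The orbit of a doubly infinite sequence $(u_j)$ is $(a_{i,j})_{(i,j)\in\mathbb{N}\times\mathbb{Z}}$ with $a_{0,j}=u_j$ and $a_{i,j}=-a_{i-1,j}-a_{i-1,j+1}$ for $i\ge1$. The $k\times k$ integer matrices are $(C_k^{(i)})_{r,s}=\sum_{\alpha\in\mathbb{Z}}\binom{i}{\alpha k+r-s}$ and $(T_k^{(i)})_{r,s}=\sum_{\alpha\in\mathbb{Z}}\alpha\binom{i}{\alpha k+r-s}$ ($r,s\in\{1,\dots,k\}$, $\binom{a}{b}=0$ for $b<0$ or $b>a$). Tuples are row vectors; products computed mod $m$. For $k_2\times k_1$ matrices $\mathbf{A}=(a_{i,j})$, $\mathbf{D}_1=(d^{(1)}_{i,j})$, $\mathbf{D}_2=(d^{(2)}_{i,j})$ (indices $0\le i\le k_2-1$, $0\le j\le k_1-1$), $\mathrm{IDAP}(\mathbf{A},\mathbf{D}_1,\mathbf{D}_2)$ is the family $(u_{i,j})_{(i,j)\in\mathbb{N}\times\mathbb{Z}}$ with $u_{i_0+ik_2,\,j_0+jk_1}=a_{i_0,j_0}+i\,d^{(2)}_{i_0,j_0}+j\,d^{(1)}_{i_0,j_0}$ for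 all $0\le i_0\le k_2-1$, $0\le j_0\le k_1-1$, $(i,j)\in\mathbb{N}\times\mathbb{Z}$. A family $(u_{i,j})_{(i,j)\in\mathbb{N}\times\mathbb{Z}}$ is $(k_1,k_2)$-interlaced doubly arithmetic if $u_{i_0+ik_2,j_0+jk_1}=u_{i_0,j_0}+i(u_{i_0+k_2,j_0}-u_{i_0,j_0})+j(u_{i_0,j_0+k_1}-u_{i_0,j_0})$ for all such $i_0,j_0,i,j$. -}

module Defs where

open import Data.Nat as ℕ using (ℕ; zero; suc; NonZero)
open import Data.Nat.Combinatorics using (_C_)
open import Data.Integer as ℤ using (ℤ; +_; -[1+_]; _+_; _*_; -_; _-_; 0ℤ; 1ℤ; _/ℕ_; _%ℕ_)
open import Data.Integer.Divisibility using (_∣_)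
open import Data.Integer.DivMod using (n%ℕd<d)
open import Data.Fin as Fin using (Fin; toℕ; fromℕ<; splitAt)
open import Data.Sum using (inj₁; inj₂)
open import Data.Vec.Functional using (Vector; _++_)
open import Relation.Binary.PropositionalEquality using (_≡_)
open import Relation.Nullary using (yes; no)
open import Data.Nat.DivMod using (m%n<n)

-- Z/mZ, represented by integer representatives; m = 0 gives Z.

_≡[_]_ : ℤ → ℕ → ℤ → Set
x ≡[ m ] y = + m ∣ (x - y)

Tuple : ℕ → Set
Tuple k = Fin k → ℤ

Matrix : ℕ → ℕ → Set
Matrix k l = Fin k → Fin l → ℤ

_≋[_]_ : ∀ {k} → Tuple k → ℕ → Tuple k → Set
u ≋[ m ] v = ∀ r → u r ≡[ m ] v r

Σ : ∀ {n} → (Fin n → ℤ) → ℤ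
Σ {zero}  f = 0ℤ
Σ {suc n} f = f Fin.zero + Σ (λ i → f (Fin.suc i))

Σ≤ : ℕ → (ℕ → ℤ) → ℤ
Σ≤ zero    f = f 0
Σ≤ (suc N) f = Σ≤ N f + f (suc N)

sgn : ℕ → ℤ
sgn zero    = 1ℤ
sgn (suc i) = - sgn i

_·ᵥ_ : ∀ {k l} → Tuple k → Matrix k l → Tuple l
(v ·ᵥ M) s = Σ (λ r → v r * M r s)

_·ₘ_ : ∀ {k l n} → Matrix k l → Matrix l n → Matrix k n
(M ·ₘ N) r s = Σ (λ t → M r t * N t s)

_+ₘ_ : ∀ {k l} → Matrix k l → Matrix k l → Matrix k l
(M +ₘ N) r s = M r s + N r s

_+ᵥ_ : ∀ {k} → Tuple k → Tuple k → Tuple k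
(u +ᵥ v) r = u r + v r

_•ᵥ_ : ∀ {k} → ℤ → Tuple k → Tuple k
(c •ᵥ v) r = c * v r

_•ₘ_ : ∀ {k l} → ℤ → Matrix k l → Matrix k l
(c •ₘ M) r s = c * M r s

Iₘ : ∀ k → Matrix k k
Iₘ k r s with toℕ r ℕ.≟ toℕ s
... | yes _ = 1ℤ
... | no  _ = 0ℤ

0ₘ : ∀ k l → Matrix k l
0ₘ k l r s = 0ℤ

block : ∀ {k l} → Matrix k l → Matrix k l → Matrix k l → Matrix k l
      → Matrix (k ℕ.+ k) (l ℕ.+ l)
block {k} {l} P Q R S r s with splitAt k r | splitAt l s
... | inj₁ r′ | inj₁ s′ = P r′ s′
... | inj₁ r′ | inj₂ s′ = Q r′ s′
... | inj₂ r′ | inj₁ s′ = R r′ s′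
... | inj₂ r′ | inj₂ s′ = S r′ s′

-- Binomial coefficient with integer lower index: binom a b = 0 for b < 0
-- (and for b > a, by the library's _C_).
binom : ℕ → ℤ → ℤ
binom a (+ b)      = + (a C b)
binom a -[1+ b ]   = 0ℤ

-- (C_k^{(i)})_{r,s} = Σ_{α∈ℤ} binom(i, αk + r − s)
-- (T_k^{(i)})_{r,s} = Σ_{α∈ℤ} α · binom(i, αk + r − s)
-- For k ≥ 1 and |r − s| < k, a nonzero term forces 0 ≤ αk + r − s ≤ i,
-- hence 0 ≤ α ≤ i; all other terms vanish, so the sum is over α = 0..i.
Cmat : (k i : ℕ) → Matrix k k
Cmat k i r s = Σ≤ i (λ α → binom i (+ α * + k + + toℕ r - + toℕ s))

Tmat : (k i : ℕ) → Matrix k k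
Tmat k i r s = Σ≤ i (λ α → + α * binom i (+ α * + k + + toℕ r - + toℕ s))

Seq : Set
Seq = ℤ → ℤ

Family : Set
Family = ℕ → ℤ → ℤ

IAP : ∀ k .{{_ : NonZero k}} → Tuple k → Tuple k → Seq
IAP k A D j = A r + (j /ℕ k) * D r
  where r = fromℕ< (n%ℕd<d j k)

orbit : Seq → Family
orbit u zero    j = u j
orbit u (suc i) j = - orbit u i j - orbit u i (j + 1ℤ)

IDAP : ∀ k₁ k₂ .{{_ : NonZero k₁}} .{{_ : NonZero k₂}}
     → Matrix k₂ k₁ → Matrix k₂ k₁ → Matrix k₂ k₁ → Family
IDAP k₁ k₂ 𝐀 𝐃₁ 𝐃₂ i j =
  𝐀 i₀ j₀ + + (i ℕ./ k₂) * 𝐃₂ i₀ j₀ + (j /ℕ k₁) * 𝐃₁ i₀ j₀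
  where
  i₀ = fromℕ< (m%n<n i k₂)
  j₀ = fromℕ< (n%ℕd<d j k₁)

InterlacedDA : ℕ → (k₁ k₂ : ℕ) → Family → Set
InterlacedDA m k₁ k₂ u =
  ∀ (i₀ : Fin k₂) (j₀ : Fin k₁) (i : ℕ) (j : ℤ) →
  let a = toℕ i₀ ; b = + toℕ j₀ in
  u (a ℕ.+ i ℕ.* k₂) (b + j * + k₁)
    ≡[ m ] (u a b + + i * (u (a ℕ.+ k₂) b - u a b)
                  + j * (u a (b + + k₁) - u a b))

_≈F[_]_ : Family → ℕ → Family → Set
u ≈F[ m ] v = ∀ i j → u i j ≡[ m ] v i j

-- Row n of the orbit of IAP(A, D) is again an interlaced arithmetic progression,
-- IAP(R_n(𝐀), R_n(𝐃₁)): by Pascal's rule the columns of C^(n) and T^(n) satisfy the orbit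
-- recurrence, T^(n) picking up a carry from C^(n) where the column index wraps around.
-- Consequently, with σ = (-1)^k₂, E = AW + DT and F = DW, the difference Δ of rows k₂ apart
-- is the orbit of IAP(σE, σF), and the difference of rows of Δ that are k₂ apart is the orbit
-- of IAP(EW + FT, FW). If F ≡ 0 and EW ≡ 0 (mod m), the rows of Δ therefore repeat with
-- period k₂ and are k₁-periodic, and as every row of the orbit is exactly k₁-interlaced
-- arithmetic, the orbit is doubly arithmetic. Conversely, the instances (i, j) = (1, 1) and
-- (2, 0) of the interlacing identity in the first rows give σF ≡ 0 and EW + FT ≡ 0. Finally,
-- (A | D) times the block matrix is (EW | F), and 𝐃₂ is row i of Δ once F ≡ 0.

module Submission where

open import Defs

-- Kept in a module of its own, so that ℤ's _+_ is not in scope at theorem11, whose statement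
-- uses ℕ's.
module OrbitOfIAP where

  open import Data.Nat.Base as ℕ using (ℕ; zero; suc; NonZero)
  import Data.Nat.Properties as ℕₚ
  import Data.Nat.DivMod as ℕₚ
  import Data.Nat.Tactic.RingSolver as ℕ-Ring
  open import Data.Nat.Combinatorics using (_C_; k>n⇒nCk≡0; nCk+nC[k+1]≡[n+1]C[k+1])
  open import Data.Integer.Base as ℤ using (ℤ; +_; -[1+_]; _+_; _*_; -_; _-_; 0ℤ; 1ℤ; -1ℤ; _/ℕ_)
  import Data.Integer.Properties as ℤₚ
  import Data.Integer.DivMod as ℤₚ
  import Data.Integer.Divisibility.Signed as Signed
  open import Data.Integer.Tactic.RingSolver using (solve-∀)
  open import Data.Fin.Base as Fin using (Fin; zero; suc; toℕ; fromℕ<; splitAt; _↑ˡ_; _↑ʳ_)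
  import Data.Fin.Properties as Finₚ
  open import Data.Product.Base using (_×_; _,_; proj₁; proj₂)
  open import Data.Sum.Base using ([_,_])
  open import Data.Vec.Functional using (_++_)
  import Data.Vec.Functional.Properties as Vectorₚ
  open import Function.Base using (_∘_)
  open import Function.Bundles using (_⇔_; mk⇔)
  open import Level using (0ℓ)
  open import Relation.Binary.Bundles using (Setoid)
  open import Relation.Binary.PropositionalEquality
  open import Relation.Nullary using (yes; no; contradiction)
  open import Relation.Binary.Definitions using (tri<; tri≈; tri>)
  import Relation.Binary.Reasoning.Setoid as SetoidReasoning
  open import Algebra.Properties.Semiring.Sum ℤₚ.+-*-semiring
    using (sum; sum-cong-≗; ∑-distrib-+; ∑-comm; sum-remove; sum-replicate-zero; *-distribˡ-sum)

  sgn-+ : ∀ a b → sgn (a ℕ.+ b) ≡ sgn a * sgn b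
  sgn-+ zero    b = sym (ℤₚ.*-identityˡ (sgn b))
  sgn-+ (suc a) b = trans (cong -_ (sgn-+ a b)) (ℤₚ.neg-distribˡ-* (sgn a) (sgn b))

  sgn-square : ∀ n → sgn n * sgn n ≡ 1ℤ
  sgn-square zero    = refl
  sgn-square (suc n) = trans (neg-square (sgn n)) (sgn-square n)
    where
    neg-square : ∀ x → - x * - x ≡ x * x
    neg-square = solve-∀

  sgn-*-sub : ∀ n a x → sgn n * a - x ≡ sgn n * (a - sgn n * x)
  sgn-*-sub n a x = begin
    sgn n * a - x                    ≡⟨ cong (λ y → sgn n * a - y) (ℤₚ.*-identityˡ x) ⟨
    sgn n * a - 1ℤ * x               ≡⟨ cong (λ σ² → sgn n * a - σ² * x) (sgn-square n) ⟨
    sgn n * a - (sgn n * sgn n) * x  ≡⟨ distribute (sgn n) a x ⟨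
    sgn n * (a - sgn n * x)          ∎
    where
    open ≡-Reasoning
    distribute : ∀ σ a x → σ * (a - σ * x) ≡ σ * a - (σ * σ) * x
    distribute = solve-∀

  -- A record around _≡[_]_, so that x and y can be inferred from a proof
  -- (_≡[_]_ unfolds to divisibility of the natural number ∣ x - y ∣).
  infix 4 _≡_[mod_]
  record _≡_[mod_] (x y : ℤ) (m : ℕ) : Set where
    constructor ≡[]⇒≡mod
    field ≡mod⇒≡[] : x ≡[ m ] y
  open _≡_[mod_]

  module _ {m : ℕ} where

    private
      by-difference : ∀ {x y z} → x - y ≡ z → + m Signed.∣ z → x ≡ y [mod m ]
      by-difference eq = ≡[]⇒≡mod ∘ Signed.∣⇒∣ᵤ ∘ subst (+ m Signed.∣_) (sym eq)

      difference : ∀ {x y} → x ≡ y [mod m ] → + m Signed.∣ (x - y)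
      difference = Signed.∣ᵤ⇒∣ ∘ ≡mod⇒≡[]

    ≡⇒≡mod : ∀ {x y} → x ≡ y → x ≡ y [mod m ]
    ≡⇒≡mod {x} refl = by-difference (ℤₚ.+-inverseʳ x) (Signed.divides 0ℤ refl)

    ≡mod-sym : ∀ {x y} → x ≡ y [mod m ] → y ≡ x [mod m ]
    ≡mod-sym {x} {y} p = by-difference (swap x y) (Signed.∣m⇒∣-m (difference p))
      where
      swap : ∀ x y → y - x ≡ - (x - y)
      swap = solve-∀

    ≡mod-trans : ∀ {x y z} → x ≡ y [mod m ] → y ≡ z [mod m ] → x ≡ z [mod m ]
    ≡mod-trans {x} {y} {z} p q =
      by-difference (telescope x y z) (Signed.∣m∣n⇒∣m+n (difference p) (difference q))
      where
      telescope : ∀ x y z → x - z ≡ (x - y) + (y - z)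
      telescope = solve-∀

    +-cong-mod : ∀ {x x′ y y′} → x ≡ x′ [mod m ] → y ≡ y′ [mod m ] → x + y ≡ x′ + y′ [mod m ]
    +-cong-mod {x} {x′} {y} {y′} p q =
      by-difference (regroup x x′ y y′) (Signed.∣m∣n⇒∣m+n (difference p) (difference q))
      where
      regroup : ∀ x x′ y y′ → (x + y) - (x′ + y′) ≡ (x - x′) + (y - y′)
      regroup = solve-∀

    *-congˡ-mod : ∀ c {x y} → x ≡ y [mod m ] → c * x ≡ c * y [mod m ]
    *-congˡ-mod c {x} {y} p = by-difference (factor c x y) (Signed.∣n⇒∣m*n c (difference p))
      where
      factor : ∀ c x y → c * x - c * y ≡ c * (x - y)
      factor = solve-∀

    neg-cong-mod : ∀ {x y} → x ≡ y [mod m ] → - x ≡ - y [mod m ]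
    neg-cong-mod {x} {y} p = by-difference (factor x y) (Signed.∣m⇒∣-m (difference p))
      where
      factor : ∀ x y → - x - - y ≡ - (x - y)
      factor = solve-∀

    minus-cong-mod : ∀ {x x′ y y′} → x ≡ x′ [mod m ] → y ≡ y′ [mod m ] → x - y ≡ x′ - y′ [mod m ]
    minus-cong-mod p q = +-cong-mod p (neg-cong-mod q)

    +-congˡ-mod : ∀ x {y y′} → y ≡ y′ [mod m ] → x + y ≡ x + y′ [mod m ]
    +-congˡ-mod x = +-cong-mod (≡⇒≡mod {x = x} refl)

    minus-congʳ-mod : ∀ y {x x′} → x ≡ x′ [mod m ] → x - y ≡ x′ - y [mod m ]
    minus-congʳ-mod y p = minus-cong-mod p (≡⇒≡mod {x = y} refl)

    *ˡ-≡mod-0 : ∀ c {x} → x ≡ 0ℤ [mod m ] → c * x ≡ 0ℤ [mod m ]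
    *ˡ-≡mod-0 c p = ≡mod-trans (*-congˡ-mod c p) (≡⇒≡mod (ℤₚ.*-zeroʳ c))

    +-≡mod-0-cancelʳ : ∀ {x y} → x + y ≡ 0ℤ [mod m ] → y ≡ 0ℤ [mod m ] → x ≡ 0ℤ [mod m ]
    +-≡mod-0-cancelʳ {x} {y} x+y≡0 y≡0 =
      ≡mod-trans (≡⇒≡mod (cancel x y)) (minus-cong-mod x+y≡0 y≡0)
      where
      cancel : ∀ x y → x ≡ x + y - y
      cancel = solve-∀

  ≡mod-setoid : ℕ → Setoid 0ℓ 0ℓ
  ≡mod-setoid m = record
    { Carrier       = ℤ
    ; _≈_           = λ x y → x ≡ y [mod m ]
    ; isEquivalence = record { refl = ≡⇒≡mod refl ; sym = ≡mod-sym ; trans = ≡mod-trans }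
    }

  module ≡mod-Reasoning (m : ℕ) = SetoidReasoning (≡mod-setoid m)

  sgn-*-≡mod-0 : ∀ {m} n {x} → sgn n * x ≡ 0ℤ [mod m ] → x ≡ 0ℤ [mod m ]
  sgn-*-≡mod-0 {m} n {x} p = begin
    x                    ≡⟨ ℤₚ.*-identityˡ x ⟨
    1ℤ * x               ≡⟨ cong (_* x) (sgn-square n) ⟨
    sgn n * sgn n * x    ≡⟨ ℤₚ.*-assoc (sgn n) (sgn n) x ⟩
    sgn n * (sgn n * x)  ≈⟨ *-congˡ-mod (sgn n) p ⟩
    sgn n * 0ℤ           ≡⟨ ℤₚ.*-zeroʳ (sgn n) ⟩
    0ℤ                   ∎
    where open ≡mod-Reasoning m

  affine-mod : ∀ {m} (h : ℕ → ℤ) d → (∀ i → h (suc i) - h i ≡ d [mod m ]) →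
               ∀ i → h i ≡ h 0 + + i * d [mod m ]
  affine-mod h d step zero    = ≡⇒≡mod (sym (ℤₚ.+-identityʳ (h 0)))
  affine-mod {m} h d step (suc i) = begin
    h (suc i)                    ≡⟨ telescope (h (suc i)) (h i) ⟩
    (h (suc i) - h i) + h i      ≈⟨ +-cong-mod (step i) (affine-mod h d step i) ⟩
    d + (h 0 + + i * d)          ≡⟨ regroup d (h 0) (+ i) ⟩
    h 0 + + suc i * d            ∎
    where
    open ≡mod-Reasoning m
    telescope : ∀ x y → x ≡ (x - y) + y
    telescope = solve-∀
    regroup : ∀ d h i → d + (h + i * d) ≡ h + (1ℤ + i) * d
    regroup = solve-∀

  bilinear-mod : ∀ {m} (i j x₀ x₁ d₀ d₁ : ℤ) {y₀ y₁} →
                 y₀ ≡ x₀ + i * d₀ [mod m ] → y₁ ≡ x₁ + i * d₁ [mod m ] → d₁ - d₀ ≡ 0ℤ [mod m ] →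
                 y₀ + j * (y₁ - y₀) ≡ x₀ + i * d₀ + j * (x₁ - x₀) [mod m ]
  bilinear-mod {m} i j x₀ x₁ d₀ d₁ {y₀} {y₁} y₀≡ y₁≡ d₁≡d₀ = begin
    y₀ + j * (y₁ - y₀)
      ≈⟨ +-cong-mod y₀≡ (*-congˡ-mod j (minus-cong-mod y₁≡ y₀≡)) ⟩
    x₀ + i * d₀ + j * ((x₁ + i * d₁) - (x₀ + i * d₀))
      ≡⟨ expand x₀ x₁ d₀ d₁ i j ⟩
    x₀ + i * d₀ + j * (x₁ - x₀) + (j * i) * (d₁ - d₀)
      ≈⟨ +-congˡ-mod (x₀ + i * d₀ + j * (x₁ - x₀)) (*ˡ-≡mod-0 (j * i) d₁≡d₀) ⟩
    x₀ + i * d₀ + j * (x₁ - x₀) + 0ℤ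
      ≡⟨ ℤₚ.+-identityʳ _ ⟩
    x₀ + i * d₀ + j * (x₁ - x₀) ∎
    where
    open ≡mod-Reasoning m
    expand : ∀ x₀ x₁ d₀ d₁ i j → x₀ + i * d₀ + j * ((x₁ + i * d₁) - (x₀ + i * d₀)) ≡
                                 x₀ + i * d₀ + j * (x₁ - x₀) + (j * i) * (d₁ - d₀)
    expand = solve-∀

  Σ≡sum : ∀ {n} (f : Fin n → ℤ) → Σ f ≡ sum f
  Σ≡sum {zero}  f = refl
  Σ≡sum {suc n} f = cong (_+_ (f zero)) (Σ≡sum (λ i → f (suc i)))

  Σ-cong : ∀ {n} {f g : Fin n → ℤ} → (∀ i → f i ≡ g i) → Σ f ≡ Σ g
  Σ-cong {f = f} {g} f≗g = trans (Σ≡sum f) (trans (sum-cong-≗ f≗g) (sym (Σ≡sum g)))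

  Σ-distrib-+ : ∀ {n} (f g : Fin n → ℤ) → Σ (λ i → f i + g i) ≡ Σ f + Σ g
  Σ-distrib-+ f g =
    trans (Σ≡sum (λ i → f i + g i)) (trans (∑-distrib-+ f g) (sym (cong₂ _+_ (Σ≡sum f) (Σ≡sum g))))

  *-distribˡ-Σ : ∀ {n} c (f : Fin n → ℤ) → c * Σ f ≡ Σ (λ i → c * f i)
  *-distribˡ-Σ c f = trans (cong (_*_ c) (Σ≡sum f)) (trans (*-distribˡ-sum c f) (sym (Σ≡sum (λ i → c * f i))))

  Σ-comm : ∀ {n p} (f : Fin n → Fin p → ℤ) →
           Σ (λ i → Σ (λ j → f i j)) ≡ Σ (λ j → Σ (λ i → f i j))
  Σ-comm f = begin
    Σ (λ i → Σ (f i))                    ≡⟨ Σ-cong (λ i → Σ≡sum (f i)) ⟩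
    Σ (λ i → sum (f i))                  ≡⟨ Σ≡sum (λ i → sum (f i)) ⟩
    sum (λ i → sum (f i))                ≡⟨ ∑-comm f ⟩
    sum (λ j → sum (λ i → f i j))        ≡⟨ Σ≡sum (λ j → sum (λ i → f i j)) ⟨
    Σ (λ j → sum (λ i → f i j))          ≡⟨ Σ-cong (λ j → Σ≡sum (λ i → f i j)) ⟨
    Σ (λ j → Σ (λ i → f i j))            ∎
    where open ≡-Reasoning

  Σ-δ : ∀ {n} (f : Fin n → ℤ) s → (∀ r → r ≢ s → f r ≡ 0ℤ) → Σ f ≡ f s
  Σ-δ {suc n} f s off = begin
    Σ f                                  ≡⟨ Σ≡sum f ⟩
    sum f                                ≡⟨ sum-remove f ⟩
    f s + sum (λ j → f (Fin.punchIn s j)) ≡⟨ cong (_+_ (f s)) (sum-cong-≗ (λ j → off _ (Finₚ.punchInᵢ≢i s j))) ⟩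
    f s + sum {n} (λ _ → 0ℤ)             ≡⟨ cong (_+_ (f s)) (sum-replicate-zero n) ⟩
    f s + 0ℤ                             ≡⟨ ℤₚ.+-identityʳ (f s) ⟩
    f s                                  ∎
    where open ≡-Reasoning

  Σ-↑ : ∀ k {l} (f : Fin (k ℕ.+ l) → ℤ) → Σ f ≡ Σ (λ i → f (i ↑ˡ l)) + Σ (λ i → f (k ↑ʳ i))
  Σ-↑ zero    f = sym (ℤₚ.+-identityˡ (Σ f))
  Σ-↑ (suc k) f = trans (cong (_+_ (f zero)) (Σ-↑ k (λ i → f (suc i))))
                        (sym (ℤₚ.+-assoc (f zero) _ _))

  Σ-≡mod-0 : ∀ {m n} (f : Fin n → ℤ) → (∀ i → f i ≡ 0ℤ [mod m ]) → Σ f ≡ 0ℤ [mod m ]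
  Σ-≡mod-0 {n = zero}  f f≡0 = ≡⇒≡mod refl
  Σ-≡mod-0 {n = suc n} f f≡0 =
    +-cong-mod (f≡0 zero) (Σ-≡mod-0 (λ i → f (suc i)) (λ i → f≡0 (suc i)))

  Σ≤-cong : ∀ N {f g : ℕ → ℤ} → (∀ α → f α ≡ g α) → Σ≤ N f ≡ Σ≤ N g
  Σ≤-cong zero    f≗g = f≗g 0
  Σ≤-cong (suc N) f≗g = cong₂ _+_ (Σ≤-cong N f≗g) (f≗g (suc N))

  Σ≤-distrib-+ : ∀ N (f g : ℕ → ℤ) → Σ≤ N (λ α → f α + g α) ≡ Σ≤ N f + Σ≤ N g
  Σ≤-distrib-+ zero    f g = refl
  Σ≤-distrib-+ (suc N) f g =
    trans (cong (_+ (f (suc N) + g (suc N))) (Σ≤-distrib-+ N f g))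
          (interchange (Σ≤ N f) (Σ≤ N g) (f (suc N)) (g (suc N)))
    where
    interchange : ∀ a b c d → a + b + (c + d) ≡ a + c + (b + d)
    interchange = solve-∀

  Σ≤-suc : ∀ N (f : ℕ → ℤ) → Σ≤ (suc N) f ≡ f 0 + Σ≤ N (λ α → f (suc α))
  Σ≤-suc zero    f = refl
  Σ≤-suc (suc N) f =
    trans (cong (_+ f (suc (suc N))) (Σ≤-suc N f)) (ℤₚ.+-assoc (f 0) _ (f (suc (suc N))))

  module _ {k l : ℕ} where

    ·ᵥ-column-+ : ∀ (v : Tuple k) (M N N′ : Matrix k l) s s₁ s₂ →
                  (∀ r → M r s ≡ N r s₁ + N′ r s₂) →
                  (v ·ᵥ M) s ≡ (v ·ᵥ N) s₁ + (v ·ᵥ N′) s₂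
    ·ᵥ-column-+ v M N N′ s s₁ s₂ M≡N+N′ =
      trans (Σ-cong (λ r → trans (cong (_*_ (v r)) (M≡N+N′ r)) (ℤₚ.*-distribˡ-+ (v r) _ _)))
            (Σ-distrib-+ (λ r → v r * N r s₁) (λ r → v r * N′ r s₂))

    ·ᵥ-+ₘ : ∀ (v : Tuple k) (M N : Matrix k l) s → (v ·ᵥ (M +ₘ N)) s ≡ (v ·ᵥ M) s + (v ·ᵥ N) s
    ·ᵥ-+ₘ v M N s = ·ᵥ-column-+ v (M +ₘ N) M N s s s (λ r → refl)

    ·ᵥ-•ₘ : ∀ (v : Tuple k) c (M : Matrix k l) s → (v ·ᵥ (c •ₘ M)) s ≡ c * (v ·ᵥ M) s
    ·ᵥ-•ₘ v c M s = trans (Σ-cong (λ r → swap (v r) c (M r s))) (sym (*-distribˡ-Σ c (λ r → v r * M r s)))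
      where
      swap : ∀ x c y → x * (c * y) ≡ c * (x * y)
      swap = solve-∀

    •ᵥ-·ᵥ : ∀ c (v : Tuple k) (M : Matrix k l) s → ((c •ᵥ v) ·ᵥ M) s ≡ c * (v ·ᵥ M) s
    •ᵥ-·ᵥ c v M s = trans (Σ-cong (λ r → ℤₚ.*-assoc c (v r) (M r s))) (sym (*-distribˡ-Σ c (λ r → v r * M r s)))

    +ᵥ-·ᵥ : ∀ (u v : Tuple k) (M : Matrix k l) s → ((u +ᵥ v) ·ᵥ M) s ≡ (u ·ᵥ M) s + (v ·ᵥ M) s
    +ᵥ-·ᵥ u v M s = trans (Σ-cong (λ r → ℤₚ.*-distribʳ-+ (M r s) (u r) (v r)))
                          (Σ-distrib-+ (λ r → u r * M r s) (λ r → v r * M r s))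

    ·ᵥ-≡mod-0 : ∀ {m} (v : Tuple k) (M : Matrix k l) → (∀ r → v r ≡ 0ℤ [mod m ]) →
                ∀ s → (v ·ᵥ M) s ≡ 0ℤ [mod m ]
    ·ᵥ-≡mod-0 v M v≡0 s = Σ-≡mod-0 (λ r → v r * M r s)
      (λ r → ≡mod-trans (≡⇒≡mod (ℤₚ.*-comm (v r) (M r s))) (*ˡ-≡mod-0 (M r s) (v≡0 r)))

    ·ᵥ-zero-column : ∀ (v : Tuple k) (M : Matrix k l) s → (∀ r → M r s ≡ 0ℤ) → (v ·ᵥ M) s ≡ 0ℤ
    ·ᵥ-zero-column v M s M≡0 = begin
      Σ (λ r → v r * M r s)   ≡⟨ Σ-cong (λ r → trans (cong (_*_ (v r)) (M≡0 r)) (ℤₚ.*-zeroʳ (v r))) ⟩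
      Σ {k} (λ _ → 0ℤ)        ≡⟨ Σ≡sum {k} (λ _ → 0ℤ) ⟩
      sum {k} (λ _ → 0ℤ)      ≡⟨ sum-replicate-zero k ⟩
      0ℤ                      ∎
      where open ≡-Reasoning

  ·ᵥ-·ₘ : ∀ {k l p} (v : Tuple k) (M : Matrix k l) (N : Matrix l p) s → (v ·ᵥ (M ·ₘ N)) s ≡ ((v ·ᵥ M) ·ᵥ N) s
  ·ᵥ-·ₘ v M N s = begin
    Σ (λ r → v r * Σ (λ t → M r t * N t s))   ≡⟨ Σ-cong (λ r → *-distribˡ-Σ (v r) (λ t → M r t * N t s)) ⟩
    Σ (λ r → Σ (λ t → v r * (M r t * N t s))) ≡⟨ Σ-comm (λ r t → v r * (M r t * N t s)) ⟩
    Σ (λ t → Σ (λ r → v r * (M r t * N t s))) ≡⟨ Σ-cong (λ t → Σ-cong (λ r → reassociate (v r) (M r t) (N t s))) ⟩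
    Σ (λ t → Σ (λ r → N t s * (v r * M r t))) ≡⟨ Σ-cong (λ t → *-distribˡ-Σ (N t s) (λ r → v r * M r t)) ⟨
    Σ (λ t → N t s * Σ (λ r → v r * M r t))   ≡⟨ Σ-cong (λ t → ℤₚ.*-comm (N t s) _) ⟩
    Σ (λ t → Σ (λ r → v r * M r t) * N t s)   ∎
    where
    open ≡-Reasoning
    reassociate : ∀ x y z → x * (y * z) ≡ z * (x * y)
    reassociate = solve-∀

  ·ᵥ-unit-column : ∀ {k} (v : Tuple k) (M : Matrix k k) s →
                   (∀ r → r ≢ s → M r s ≡ 0ℤ) → M s s ≡ 1ℤ → (v ·ᵥ M) s ≡ v s
  ·ᵥ-unit-column v M s off diag = begin
    Σ (λ r → v r * M r s)
      ≡⟨ Σ-δ (λ r → v r * M r s) s (λ r r≢s → trans (cong (_*_ (v r)) (off r r≢s)) (ℤₚ.*-zeroʳ (v r))) ⟩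
    v s * M s s            ≡⟨ cong (_*_ (v s)) diag ⟩
    v s * 1ℤ               ≡⟨ ℤₚ.*-identityʳ (v s) ⟩
    v s                    ∎
    where open ≡-Reasoning

  ·ᵥ-Iₘ : ∀ {k} (v : Tuple k) s → (v ·ᵥ Iₘ k) s ≡ v s
  ·ᵥ-Iₘ {k} v s = ·ᵥ-unit-column v (Iₘ k) s off diag
    where
    off : ∀ r → r ≢ s → Iₘ k r s ≡ 0ℤ
    off r r≢s with toℕ r ℕₚ.≟ toℕ s
    ... | yes r≡s = contradiction (Finₚ.toℕ-injective r≡s) r≢s
    ... | no  _   = refl
    diag : Iₘ k s s ≡ 1ℤ
    diag with toℕ s ℕₚ.≟ toℕ s
    ... | yes _   = refl
    ... | no  s≢s = contradiction refl s≢s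

  module _ {k l : ℕ} (A D : Tuple k) (P Q R S : Matrix k l) where

    private
      block-↑ˡ-↑ˡ : ∀ r s → block P Q R S (r ↑ˡ k) (s ↑ˡ l) ≡ P r s
      block-↑ˡ-↑ˡ r s rewrite Finₚ.splitAt-↑ˡ k r k | Finₚ.splitAt-↑ˡ l s l = refl
      block-↑ʳ-↑ˡ : ∀ r s → block P Q R S (k ↑ʳ r) (s ↑ˡ l) ≡ R r s
      block-↑ʳ-↑ˡ r s rewrite Finₚ.splitAt-↑ʳ k k r | Finₚ.splitAt-↑ˡ l s l = refl
      block-↑ˡ-↑ʳ : ∀ r s → block P Q R S (r ↑ˡ k) (l ↑ʳ s) ≡ Q r s
      block-↑ˡ-↑ʳ r s rewrite Finₚ.splitAt-↑ˡ k r k | Finₚ.splitAt-↑ʳ l l s = refl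
      block-↑ʳ-↑ʳ : ∀ r s → block P Q R S (k ↑ʳ r) (l ↑ʳ s) ≡ S r s
      block-↑ʳ-↑ʳ r s rewrite Finₚ.splitAt-↑ʳ k k r | Finₚ.splitAt-↑ʳ l l s = refl

    ++-·ᵥ-block-↑ˡ : ∀ s → ((A ++ D) ·ᵥ block P Q R S) (s ↑ˡ l) ≡ (A ·ᵥ P) s + (D ·ᵥ R) s
    ++-·ᵥ-block-↑ˡ s = trans (Σ-↑ k _) (cong₂ _+_
      (Σ-cong (λ r → cong₂ _*_ (Vectorₚ.lookup-++ˡ A D r) (block-↑ˡ-↑ˡ r s)))
      (Σ-cong (λ r → cong₂ _*_ (Vectorₚ.lookup-++ʳ A D r) (block-↑ʳ-↑ˡ r s))))

    ++-·ᵥ-block-↑ʳ : ∀ s → ((A ++ D) ·ᵥ block P Q R S) (l ↑ʳ s) ≡ (A ·ᵥ Q) s + (D ·ᵥ S) s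
    ++-·ᵥ-block-↑ʳ s = trans (Σ-↑ k _) (cong₂ _+_
      (Σ-cong (λ r → cong₂ _*_ (Vectorₚ.lookup-++ˡ A D r) (block-↑ˡ-↑ʳ r s)))
      (Σ-cong (λ r → cong₂ _*_ (Vectorₚ.lookup-++ʳ A D r) (block-↑ʳ-↑ʳ r s))))

  ↑-induction : ∀ {k l} (P : Fin (k ℕ.+ l) → Set) → (∀ i → P (i ↑ˡ l)) → (∀ i → P (k ↑ʳ i)) → ∀ t → P t
  ↑-induction {k} {l} P P-↑ˡ P-↑ʳ t =
    subst P (Finₚ.join-splitAt k l t) ([_,_] {C = P ∘ Fin.join k l} P-↑ˡ P-↑ʳ (splitAt k t))

  -- Column recurrences of Cmat and Tmat

  binom-pascal : ∀ n x → binom (suc n) x ≡ binom n x + binom n (x - 1ℤ)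
  binom-pascal n (+ zero)  = refl
  binom-pascal n (+ suc b) =
    cong +_ (sym (trans (ℕₚ.+-comm (n C suc b) (n C b)) (nCk+nC[k+1]≡[n+1]C[k+1] n b)))
  binom-pascal n -[1+ b ]  = refl

  binom-below : ∀ n {r k} → r ℕ.< k → binom n (+ r - + k) ≡ 0ℤ
  binom-below n {r} r<k with ℕₚ.m≤n⇒∃[o]m+o≡n r<k
  ... | d , refl = cong (binom n) (difference (+ r) (+ d))
    where
    difference : ∀ r d → r - (1ℤ + (r + d)) ≡ - (1ℤ + d)
    difference = solve-∀

  binom-top : ∀ n r {s k} → s ℕ.< k → binom n (+ suc n * + k + + r - + s) ≡ 0ℤ
  binom-top n r {s} s<k with ℕₚ.m≤n⇒∃[o]m+o≡n s<k
  ... | d , refl = begin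
    binom n (+ suc n * + suc (s ℕ.+ d) + + r - + s)
      ≡⟨ cong (binom n) (expand (+ n) (+ s) (+ d) (+ r)) ⟩
    binom n (+ n + (1ℤ + (+ n * + (s ℕ.+ d) + + d + + r)))
      ≡⟨ cong (λ x → binom n (+ n + (1ℤ + (x + + d + + r)))) (ℤₚ.pos-* n (s ℕ.+ d)) ⟨
    binom n (+ (n ℕ.+ suc (n ℕ.* (s ℕ.+ d) ℕ.+ d ℕ.+ r)))
      ≡⟨ cong +_ (k>n⇒nCk≡0 (ℕₚ.m<m+n n ℕ.z<s)) ⟩
    0ℤ ∎
    where
    open ≡-Reasoning
    expand : ∀ n s d r → (1ℤ + n) * (1ℤ + (s + d)) + r - s ≡ n + (1ℤ + (n * (s + d) + d + r))
    expand = solve-∀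

  -- Cmat k n r s = C≤ k n n (toℕ r) (toℕ s); decoupling the range N of α from n lets Pascal's
  -- rule act termwise, after which the extra term α = n + 1 vanishes (binom-top).
  C≤ T≤ : (k N n r s : ℕ) → ℤ
  C≤ k N n r s = Σ≤ N (λ α → binom n (+ α * + k + + r - + s))
  T≤ k N n r s = Σ≤ N (λ α → + α * binom n (+ α * + k + + r - + s))

  module _ (k : ℕ) where

    private
      shift-s : ∀ α k r s → α * k + r - s - 1ℤ ≡ α * k + r - (1ℤ + s)
      shift-s = solve-∀

      pascal : ∀ n α r s → binom (suc n) (+ α * + k + + r - + s) ≡
               binom n (+ α * + k + + r - + s) + binom n (+ α * + k + + r - + suc s)
      pascal n α r s = trans (binom-pascal n _)
        (cong (λ x → binom n (+ α * + k + + r - + s) + binom n x) (shift-s (+ α) (+ k) (+ r) (+ s)))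

      shift-α : ∀ α k r → (1ℤ + α) * k + r - k ≡ α * k + r - 0ℤ
      shift-α = solve-∀

    C≤-pascal : ∀ N n r s → C≤ k N (suc n) r s ≡ C≤ k N n r s + C≤ k N n r (suc s)
    C≤-pascal N n r s = trans (Σ≤-cong N (λ α → pascal n α r s)) (Σ≤-distrib-+ N _ _)

    T≤-pascal : ∀ N n r s → T≤ k N (suc n) r s ≡ T≤ k N n r s + T≤ k N n r (suc s)
    T≤-pascal N n r s = trans
      (Σ≤-cong N (λ α → trans (cong (_*_ (+ α)) (pascal n α r s)) (ℤₚ.*-distribˡ-+ (+ α) _ _)))
      (Σ≤-distrib-+ N _ _)

    C≤-top : ∀ n r s → s ℕ.< k → C≤ k (suc n) n r s ≡ C≤ k n n r s
    C≤-top n r s s<k = trans (cong (_+_ (C≤ k n n r s)) (binom-top n r s<k)) (ℤₚ.+-identityʳ _)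

    T≤-top : ∀ n r s → s ℕ.< k → T≤ k (suc n) n r s ≡ T≤ k n n r s
    T≤-top n r s s<k = begin
      T≤ k n n r s + + suc n * binom n (+ suc n * + k + + r - + s)
        ≡⟨ cong (λ x → T≤ k n n r s + + suc n * x) (binom-top n r s<k) ⟩
      T≤ k n n r s + + suc n * 0ℤ
        ≡⟨ cong (_+_ (T≤ k n n r s)) (ℤₚ.*-zeroʳ (+ suc n)) ⟩
      T≤ k n n r s + 0ℤ
        ≡⟨ ℤₚ.+-identityʳ _ ⟩
      T≤ k n n r s ∎
      where open ≡-Reasoning

    C≤-wrap : ∀ N n r → r ℕ.< k → C≤ k (suc N) n r k ≡ C≤ k N n r 0
    C≤-wrap N n r r<k = begin
      C≤ k (suc N) n r k
        ≡⟨ Σ≤-suc N _ ⟩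
      binom n (0ℤ * + k + + r - + k) + Σ≤ N (λ α → binom n (+ suc α * + k + + r - + k))
        ≡⟨ cong₂ _+_ (cong (binom n) (drop-0 (+ k) (+ r)))
                     (Σ≤-cong N (λ α → cong (binom n) (shift-α (+ α) (+ k) (+ r)))) ⟩
      binom n (+ r - + k) + C≤ k N n r 0
        ≡⟨ cong (_+ C≤ k N n r 0) (binom-below n r<k) ⟩
      0ℤ + C≤ k N n r 0
        ≡⟨ ℤₚ.+-identityˡ _ ⟩
      C≤ k N n r 0 ∎
      where
      open ≡-Reasoning
      drop-0 : ∀ k r → 0ℤ * k + r - k ≡ r - k
      drop-0 = solve-∀

    T≤-wrap : ∀ N n r → r ℕ.< k → T≤ k (suc N) n r k ≡ T≤ k N n r 0 + C≤ k N n r 0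
    T≤-wrap N n r r<k = begin
      T≤ k (suc N) n r k
        ≡⟨ Σ≤-suc N _ ⟩
      0ℤ * binom n (0ℤ * + k + + r - + k) + Σ≤ N (λ α → (1ℤ + + α) * binom n (+ suc α * + k + + r - + k))
        ≡⟨ cong₂ _+_ (ℤₚ.*-zeroˡ (binom n (0ℤ * + k + + r - + k))) (Σ≤-cong N (λ α →
             trans (suc-* (+ α) _) (cong (λ x → binom n x + + α * binom n x) (shift-α (+ α) (+ k) (+ r))))) ⟩
      0ℤ + Σ≤ N (λ α → binom n (+ α * + k + + r - 0ℤ) + + α * binom n (+ α * + k + + r - 0ℤ))
        ≡⟨ ℤₚ.+-identityˡ _ ⟩
      Σ≤ N (λ α → binom n (+ α * + k + + r - 0ℤ) + + α * binom n (+ α * + k + + r - 0ℤ))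
        ≡⟨ Σ≤-distrib-+ N _ _ ⟩
      C≤ k N n r 0 + T≤ k N n r 0
        ≡⟨ ℤₚ.+-comm (C≤ k N n r 0) (T≤ k N n r 0) ⟩
      T≤ k N n r 0 + C≤ k N n r 0 ∎
      where
      open ≡-Reasoning
      suc-* : ∀ a x → (1ℤ + a) * x ≡ x + a * x
      suc-* = solve-∀

  module _ {k : ℕ} where

    Cmat-step : ∀ n (r s s′ : Fin k) → toℕ s′ ≡ suc (toℕ s) →
                Cmat k (suc n) r s ≡ Cmat k n r s + Cmat k n r s′
    Cmat-step n r s s′ s′≡1+s = begin
      C≤ k (suc n) (suc n) (toℕ r) (toℕ s)
        ≡⟨ C≤-pascal k (suc n) n (toℕ r) (toℕ s) ⟩
      C≤ k (suc n) n (toℕ r) (toℕ s) + C≤ k (suc n) n (toℕ r) (suc (toℕ s))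
        ≡⟨ cong₂ _+_ (C≤-top k n (toℕ r) (toℕ s) (Finₚ.toℕ<n s))
                     (C≤-top k n (toℕ r) (suc (toℕ s)) (subst (ℕ._< k) s′≡1+s (Finₚ.toℕ<n s′))) ⟩
      C≤ k n n (toℕ r) (toℕ s) + C≤ k n n (toℕ r) (suc (toℕ s))
        ≡⟨ cong (λ t → C≤ k n n (toℕ r) (toℕ s) + C≤ k n n (toℕ r) t) s′≡1+s ⟨
      C≤ k n n (toℕ r) (toℕ s) + C≤ k n n (toℕ r) (toℕ s′) ∎
      where open ≡-Reasoning

    Tmat-step : ∀ n (r s s′ : Fin k) → toℕ s′ ≡ suc (toℕ s) →
                Tmat k (suc n) r s ≡ Tmat k n r s + Tmat k n r s′
    Tmat-step n r s s′ s′≡1+s = begin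
      T≤ k (suc n) (suc n) (toℕ r) (toℕ s)
        ≡⟨ T≤-pascal k (suc n) n (toℕ r) (toℕ s) ⟩
      T≤ k (suc n) n (toℕ r) (toℕ s) + T≤ k (suc n) n (toℕ r) (suc (toℕ s))
        ≡⟨ cong₂ _+_ (T≤-top k n (toℕ r) (toℕ s) (Finₚ.toℕ<n s))
                     (T≤-top k n (toℕ r) (suc (toℕ s)) (subst (ℕ._< k) s′≡1+s (Finₚ.toℕ<n s′))) ⟩
      T≤ k n n (toℕ r) (toℕ s) + T≤ k n n (toℕ r) (suc (toℕ s))
        ≡⟨ cong (λ t → T≤ k n n (toℕ r) (toℕ s) + T≤ k n n (toℕ r) t) s′≡1+s ⟨
      T≤ k n n (toℕ r) (toℕ s) + T≤ k n n (toℕ r) (toℕ s′) ∎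
      where open ≡-Reasoning

  module _ {k : ℕ} where

    Cmat-wrap : ∀ n (r s : Fin (suc k)) → toℕ s ≡ k →
                Cmat (suc k) (suc n) r s ≡ Cmat (suc k) n r s + Cmat (suc k) n r zero
    Cmat-wrap n r s s≡k = begin
      C≤ (suc k) (suc n) (suc n) (toℕ r) (toℕ s)
        ≡⟨ C≤-pascal (suc k) (suc n) n (toℕ r) (toℕ s) ⟩
      C≤ (suc k) (suc n) n (toℕ r) (toℕ s) + C≤ (suc k) (suc n) n (toℕ r) (suc (toℕ s))
        ≡⟨ cong₂ _+_ (C≤-top (suc k) n (toℕ r) (toℕ s) (Finₚ.toℕ<n s))
                     (trans (cong (C≤ (suc k) (suc n) n (toℕ r) ∘ suc) s≡k)
                            (C≤-wrap (suc k) n n (toℕ r) (Finₚ.toℕ<n r))) ⟩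
      C≤ (suc k) n n (toℕ r) (toℕ s) + C≤ (suc k) n n (toℕ r) 0 ∎
      where open ≡-Reasoning

    Tmat-wrap : ∀ n (r s : Fin (suc k)) → toℕ s ≡ k →
                Tmat (suc k) (suc n) r s ≡ Tmat (suc k) n r s + (Tmat (suc k) n r zero + Cmat (suc k) n r zero)
    Tmat-wrap n r s s≡k = begin
      T≤ (suc k) (suc n) (suc n) (toℕ r) (toℕ s)
        ≡⟨ T≤-pascal (suc k) (suc n) n (toℕ r) (toℕ s) ⟩
      T≤ (suc k) (suc n) n (toℕ r) (toℕ s) + T≤ (suc k) (suc n) n (toℕ r) (suc (toℕ s))
        ≡⟨ cong₂ _+_ (T≤-top (suc k) n (toℕ r) (toℕ s) (Finₚ.toℕ<n s))
                     (trans (cong (T≤ (suc k) (suc n) n (toℕ r) ∘ suc) s≡k)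
                            (T≤-wrap (suc k) n n (toℕ r) (Finₚ.toℕ<n r))) ⟩
      T≤ (suc k) n n (toℕ r) (toℕ s) + (T≤ (suc k) n n (toℕ r) 0 + C≤ (suc k) n n (toℕ r) 0) ∎
      where open ≡-Reasoning

  module _ {k : ℕ} (n : ℕ) (v : Tuple k) (s s′ : Fin k) (s′≡1+s : toℕ s′ ≡ suc (toℕ s)) where

    ·ᵥ-Cmat-step : (v ·ᵥ Cmat k (suc n)) s ≡ (v ·ᵥ Cmat k n) s + (v ·ᵥ Cmat k n) s′
    ·ᵥ-Cmat-step = ·ᵥ-column-+ v (Cmat k (suc n)) (Cmat k n) (Cmat k n) s s s′ (λ r → Cmat-step n r s s′ s′≡1+s)

    ·ᵥ-Tmat-step : (v ·ᵥ Tmat k (suc n)) s ≡ (v ·ᵥ Tmat k n) s + (v ·ᵥ Tmat k n) s′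
    ·ᵥ-Tmat-step = ·ᵥ-column-+ v (Tmat k (suc n)) (Tmat k n) (Tmat k n) s s s′ (λ r → Tmat-step n r s s′ s′≡1+s)

  module _ {k : ℕ} (n : ℕ) (v : Tuple (suc k)) (s : Fin (suc k)) (s≡k : toℕ s ≡ k) where

    ·ᵥ-Cmat-wrap : (v ·ᵥ Cmat (suc k) (suc n)) s ≡ (v ·ᵥ Cmat (suc k) n) s + (v ·ᵥ Cmat (suc k) n) zero
    ·ᵥ-Cmat-wrap = ·ᵥ-column-+ v (Cmat (suc k) (suc n)) (Cmat (suc k) n) (Cmat (suc k) n) s s zero
                               (λ r → Cmat-wrap n r s s≡k)

    ·ᵥ-Tmat-wrap : (v ·ᵥ Tmat (suc k) (suc n)) s ≡
                   (v ·ᵥ Tmat (suc k) n) s + ((v ·ᵥ Tmat (suc k) n) zero + (v ·ᵥ Cmat (suc k) n) zero)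
    ·ᵥ-Tmat-wrap = trans
      (·ᵥ-column-+ v (Tmat (suc k) (suc n)) (Tmat (suc k) n) (Tmat (suc k) n +ₘ Cmat (suc k) n) s s zero
                   (λ r → Tmat-wrap n r s s≡k))
      (cong (_+_ ((v ·ᵥ Tmat (suc k) n) s)) (·ᵥ-+ₘ v (Tmat (suc k) n) (Cmat (suc k) n) zero))

  ·ᵥ-Cmat-0 : ∀ {k} (v : Tuple k) s → (v ·ᵥ Cmat k 0) s ≡ v s
  ·ᵥ-Cmat-0 {k} v s = ·ᵥ-unit-column v (Cmat k 0) s off (cong (binom 0) (ℤₚ.+-inverseʳ (+ toℕ s)))
    where
    off : ∀ r → r ≢ s → Cmat k 0 r s ≡ 0ℤ
    off r r≢s with + toℕ r - + toℕ s in eq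
    ... | + zero   = contradiction (Finₚ.toℕ-injective (ℤₚ.+-injective (ℤₚ.i-j≡0⇒i≡j _ _ eq))) r≢s
    ... | + suc _  = refl
    ... | -[1+ _ ] = refl

  ·ᵥ-Tmat-0 : ∀ {k} (v : Tuple k) s → (v ·ᵥ Tmat k 0) s ≡ 0ℤ
  ·ᵥ-Tmat-0 {k} v s = ·ᵥ-zero-column v (Tmat k 0) s (λ r → refl)

  rowA : (k n : ℕ) → Tuple k → Tuple k → Tuple k
  rowA k n A D = sgn n •ᵥ ((A ·ᵥ Cmat k n) +ᵥ (D ·ᵥ Tmat k n))

  rowD : (k n : ℕ) → Tuple k → Tuple k
  rowD k n D = sgn n •ᵥ (D ·ᵥ Cmat k n)

  rowA-0 : ∀ {k} (A D : Tuple k) s → rowA k 0 A D s ≡ A s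
  rowA-0 A D s = trans (ℤₚ.*-identityˡ _)
    (trans (cong₂ _+_ (·ᵥ-Cmat-0 A s) (·ᵥ-Tmat-0 D s)) (ℤₚ.+-identityʳ (A s)))

  rowD-0 : ∀ {k} (D : Tuple k) s → rowD k 0 D s ≡ D s
  rowD-0 D s = trans (ℤₚ.*-identityˡ _) (·ᵥ-Cmat-0 D s)

  private
    neg-split₂ : ∀ σ c c′ → - σ * (c + c′) ≡ - (σ * c) - σ * c′
    neg-split₂ = solve-∀

  module _ {k : ℕ} (n : ℕ) {b b′ : Fin k} (b′≡1+b : toℕ b′ ≡ suc (toℕ b)) where

    rowA-step : ∀ (A D : Tuple k) → rowA k (suc n) A D b ≡ - rowA k n A D b - rowA k n A D b′
    rowA-step A D = trans
      (cong (_*_ (- sgn n)) (cong₂ _+_ (·ᵥ-Cmat-step n A b b′ b′≡1+b) (·ᵥ-Tmat-step n D b b′ b′≡1+b)))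
      (neg-split₄ (sgn n) ((A ·ᵥ Cmat k n) b) ((A ·ᵥ Cmat k n) b′) ((D ·ᵥ Tmat k n) b) ((D ·ᵥ Tmat k n) b′))
      where
      neg-split₄ : ∀ σ a a′ t t′ → - σ * ((a + a′) + (t + t′)) ≡ - (σ * (a + t)) - σ * (a′ + t′)
      neg-split₄ = solve-∀

    rowD-step : ∀ (D : Tuple k) → rowD k (suc n) D b ≡ - rowD k n D b - rowD k n D b′
    rowD-step D = trans (cong (_*_ (- sgn n)) (·ᵥ-Cmat-step n D b b′ b′≡1+b))
      (neg-split₂ (sgn n) ((D ·ᵥ Cmat k n) b) ((D ·ᵥ Cmat k n) b′))

  module _ {k : ℕ} (n : ℕ) {b : Fin (suc k)} (b≡k : toℕ b ≡ k) where

    private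
      C T : ℕ → Matrix (suc k) (suc k)
      C = Cmat (suc k)
      T = Tmat (suc k)

    rowA-wrap : ∀ (A D : Tuple (suc k)) → rowA (suc k) (suc n) A D b ≡
                - rowA (suc k) n A D b - (rowA (suc k) n A D zero + rowD (suc k) n D zero)
    rowA-wrap A D = trans (cong (_*_ (- sgn n)) (cong₂ _+_ (·ᵥ-Cmat-wrap n A b b≡k) (·ᵥ-Tmat-wrap n D b b≡k)))
      (neg-split₅ (sgn n) ((A ·ᵥ C n) b) ((A ·ᵥ C n) zero) ((D ·ᵥ T n) b) ((D ·ᵥ T n) zero) ((D ·ᵥ C n) zero))
      where
      neg-split₅ : ∀ σ a a₀ t t₀ c₀ →
                   - σ * ((a + a₀) + (t + (t₀ + c₀))) ≡ - (σ * (a + t)) - (σ * (a₀ + t₀) + σ * c₀)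
      neg-split₅ = solve-∀

    rowD-wrap : ∀ (D : Tuple (suc k)) → rowD (suc k) (suc n) D b ≡ - rowD (suc k) n D b - rowD (suc k) n D zero
    rowD-wrap D = trans (cong (_*_ (- sgn n)) (·ᵥ-Cmat-wrap n D b b≡k))
      (neg-split₂ (sgn n) ((D ·ᵥ C n) b) ((D ·ᵥ C n) zero))

  -- Interlaced arithmetic progressions

  private
    +-*-<-mono : ∀ k {b b′} (q q′ : ℤ) → b ℕ.< k → q ℤ.< q′ → + b + q * + k ℤ.< + b′ + q′ * + k
    +-*-<-mono k {b} {b′} q q′ b<k q<q′ = begin-strict
      + b + q * + k   <⟨ ℤₚ.+-monoˡ-< (q * + k) (ℤ.+<+ b<k) ⟩
      + k + q * + k   ≡⟨ ℤₚ.suc-* q (+ k) ⟨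
      ℤ.suc q * + k   ≤⟨ ℤₚ.*-monoʳ-≤-nonNeg (+ k) (ℤₚ.i<j⇒suc[i]≤j q<q′) ⟩
      q′ * + k        ≤⟨ ℤₚ.i≤j+i (q′ * + k) (+ b′) ⟩
      + b′ + q′ * + k ∎
      where open ℤₚ.≤-Reasoning

    quotient-unique : ∀ k {b b′} (q q′ : ℤ) → b ℕ.< k → b′ ℕ.< k →
                      + b + q * + k ≡ + b′ + q′ * + k → q ≡ q′
    quotient-unique k q q′ b<k b′<k eq with ℤₚ.<-cmp q q′
    ... | tri< q<q′ _ _ = contradiction eq (ℤₚ.<⇒≢ (+-*-<-mono k q q′ b<k q<q′))
    ... | tri≈ _ q≡q′ _ = q≡q′
    ... | tri> _ _ q>q′ = contradiction (sym eq) (ℤₚ.<⇒≢ (+-*-<-mono k q′ q b′<k q>q′))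

    remainder-unique : ∀ k {b b′} (q q′ : ℤ) → b ℕ.< k → b′ ℕ.< k →
                       + b + q * + k ≡ + b′ + q′ * + k → b ≡ b′
    remainder-unique k {b} {b′} q q′ b<k b′<k eq = ℤₚ.+-injective (begin
      + b                          ≡⟨ cancel (+ b) q (+ k) ⟨
      + b + q * + k - q * + k      ≡⟨ cong₂ (λ x y → x - y * + k) eq (quotient-unique k q q′ b<k b′<k eq) ⟩
      + b′ + q′ * + k - q′ * + k   ≡⟨ cancel (+ b′) q′ (+ k) ⟩
      + b′                         ∎)
      where
      open ≡-Reasoning
      cancel : ∀ b q k → b + q * k - q * k ≡ b
      cancel = solve-∀

  module _ (k : ℕ) .{{_ : NonZero k}} where

    residue : ℤ → Fin k
    residue j = fromℕ< (ℤₚ.n%ℕd<d j k)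

    residue-quotient : ∀ j → j ≡ + toℕ (residue j) + (j /ℕ k) * + k
    residue-quotient j = trans (ℤₚ.a≡a%ℕn+[a/ℕn]*n j k)
      (cong (λ r → + r + (j /ℕ k) * + k) (sym (Finₚ.toℕ-fromℕ< (ℤₚ.n%ℕd<d j k))))

    residue-quotient-unique : ∀ (b : Fin k) q → residue (+ toℕ b + q * + k) ≡ b × (+ toℕ b + q * + k) /ℕ k ≡ q
    residue-quotient-unique b q =
      Finₚ.toℕ-injective (sym (remainder-unique k q (j /ℕ k) (Finₚ.toℕ<n b) (Finₚ.toℕ<n (residue j)) j≡))
      , sym (quotient-unique k q (j /ℕ k) (Finₚ.toℕ<n b) (Finₚ.toℕ<n (residue j)) j≡)
      where
      j : ℤ
      j = + toℕ b + q * + k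
      j≡ : j ≡ + toℕ (residue j) + (j /ℕ k) * + k
      j≡ = residue-quotient j

    IAP-eval : ∀ (X Y : Tuple k) (b : Fin k) q → IAP k X Y (+ toℕ b + q * + k) ≡ X b + q * Y b
    IAP-eval X Y b q = cong₂ (λ r q → X r + q * Y r) (proj₁ (residue-quotient-unique b q)) (proj₂ (residue-quotient-unique b q))

    IAP-eval₀ : ∀ (X Y : Tuple k) (b : Fin k) → IAP k X Y (+ toℕ b) ≡ X b
    IAP-eval₀ X Y b = begin
      IAP k X Y (+ toℕ b)               ≡⟨ cong (IAP k X Y) (ℤₚ.+-identityʳ (+ toℕ b)) ⟨
      IAP k X Y (+ toℕ b + 0ℤ * + k)    ≡⟨ IAP-eval X Y b 0ℤ ⟩
      X b + 0ℤ * Y b                    ≡⟨ ℤₚ.+-identityʳ (X b) ⟩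
      X b                               ∎
      where open ≡-Reasoning

    IAP-eval₁ : ∀ (X Y : Tuple k) (b : Fin k) → IAP k X Y (+ toℕ b + + k) ≡ X b + Y b
    IAP-eval₁ X Y b = begin
      IAP k X Y (+ toℕ b + + k)         ≡⟨ cong (λ x → IAP k X Y (+ toℕ b + x)) (ℤₚ.*-identityˡ (+ k)) ⟨
      IAP k X Y (+ toℕ b + 1ℤ * + k)    ≡⟨ IAP-eval X Y b 1ℤ ⟩
      X b + 1ℤ * Y b                    ≡⟨ cong (_+_ (X b)) (ℤₚ.*-identityˡ (Y b)) ⟩
      X b + Y b                         ∎
      where open ≡-Reasoning

    IAP-arithmetic : ∀ (X Y : Tuple k) (b : Fin k) j → let u = IAP k X Y ; c = + toℕ b in
                     u (c + j * + k) ≡ u c + j * (u (c + + k) - u c)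
    IAP-arithmetic X Y b j = begin
      IAP k X Y (+ toℕ b + j * + k)  ≡⟨ IAP-eval X Y b j ⟩
      X b + j * Y b                  ≡⟨ cancel (X b) (Y b) j ⟩
      X b + j * (X b + Y b - X b)    ≡⟨ cong₂ (λ x y → x + j * (y - x)) (IAP-eval₀ X Y b) (IAP-eval₁ X Y b) ⟨
      _                              ∎
      where
      open ≡-Reasoning
      cancel : ∀ x y j → x + j * y ≡ x + j * (x + y - x)
      cancel = solve-∀

    residue-induction : (P : ℤ → Set) → (∀ b q → P (+ toℕ b + q * + k)) → ∀ j → P j
    residue-induction P P-b+qk j = subst P (sym (residue-quotient j)) (P-b+qk (residue j) (j /ℕ k))

    IAP-cong : ∀ {X Y X′ Y′ : Tuple k} → (∀ s → X s ≡ X′ s) → (∀ s → Y s ≡ Y′ s) →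
               ∀ j → IAP k X Y j ≡ IAP k X′ Y′ j
    IAP-cong X≗X′ Y≗Y′ j = cong₂ (λ x y → x + (j /ℕ k) * y) (X≗X′ (residue j)) (Y≗Y′ (residue j))

    IAP-sub : ∀ (X Y X′ Y′ : Tuple k) j →
              IAP k X Y j - IAP k X′ Y′ j ≡ IAP k (λ s → X s - X′ s) (λ s → Y s - Y′ s) j
    IAP-sub X Y X′ Y′ j = distribute (X (residue j)) (Y (residue j)) (X′ (residue j)) (Y′ (residue j)) (j /ℕ k)
      where
      distribute : ∀ x y x′ y′ q → (x + q * y) - (x′ + q * y′) ≡ (x - x′) + q * (y - y′)
      distribute = solve-∀

    IAP-≡mod-0 : ∀ {m} (X Y : Tuple k) → (∀ s → X s ≡ 0ℤ [mod m ]) → (∀ s → Y s ≡ 0ℤ [mod m ]) →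
                 ∀ j → IAP k X Y j ≡ 0ℤ [mod m ]
    IAP-≡mod-0 X Y X≡0 Y≡0 j = +-cong-mod (X≡0 (residue j)) (*ˡ-≡mod-0 (j /ℕ k) (Y≡0 (residue j)))

  module _ {k : ℕ} (X Y : Tuple (suc k)) where

    private
      K : ℕ
      K = suc k

    IAP-suc-inner : ∀ (b b′ : Fin K) q → toℕ b′ ≡ suc (toℕ b) →
                    IAP K X Y (+ toℕ b + q * + K + 1ℤ) ≡ X b′ + q * Y b′
    IAP-suc-inner b b′ q b′≡1+b = trans
      (cong (IAP K X Y) (trans (shift (+ toℕ b) q (+ K)) (cong (λ x → + x + q * + K) (sym b′≡1+b))))
      (IAP-eval K X Y b′ q)
      where
      shift : ∀ b q k → b + q * k + 1ℤ ≡ (1ℤ + b) + q * k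
      shift = solve-∀

    IAP-suc-last : ∀ (b : Fin K) q → toℕ b ≡ k →
                   IAP K X Y (+ toℕ b + q * + K + 1ℤ) ≡ (X zero + Y zero) + q * Y zero
    IAP-suc-last b q b≡k = begin
      IAP K X Y (+ toℕ b + q * + K + 1ℤ)        ≡⟨ cong (λ i → IAP K X Y (+ i + q * + K + 1ℤ)) b≡k ⟩
      IAP K X Y (+ k + q * + K + 1ℤ)            ≡⟨ cong (IAP K X Y) (carry (+ k) q) ⟩
      IAP K X Y (0ℤ + (q + 1ℤ) * + K)           ≡⟨ IAP-eval K X Y zero (q + 1ℤ) ⟩
      X zero + (q + 1ℤ) * Y zero                ≡⟨ regroup (X zero) (Y zero) q ⟩
      (X zero + Y zero) + q * Y zero            ∎
      where
      open ≡-Reasoning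
      carry : ∀ k q → k + q * (1ℤ + k) + 1ℤ ≡ 0ℤ + (q + 1ℤ) * (1ℤ + k)
      carry = solve-∀
      regroup : ∀ x y q → x + (q + 1ℤ) * y ≡ (x + y) + q * y
      regroup = solve-∀

    IAP-orbit-step : ∀ (X′ Y′ : Tuple K) →
      (∀ b b′ → toℕ b′ ≡ suc (toℕ b) → X′ b ≡ - X b - X b′ × Y′ b ≡ - Y b - Y b′) →
      (∀ b → toℕ b ≡ k → X′ b ≡ - X b - (X zero + Y zero) × Y′ b ≡ - Y b - Y zero) →
      ∀ j → - IAP K X Y j - IAP K X Y (j + 1ℤ) ≡ IAP K X′ Y′ j
    IAP-orbit-step X′ Y′ inner last = residue-induction K _ step
      where
      conclude : ∀ b q x′ y′ → IAP K X Y (+ toℕ b + q * + K + 1ℤ) ≡ x′ + q * y′ →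
                 X′ b ≡ - X b - x′ → Y′ b ≡ - Y b - y′ →
                 - IAP K X Y (+ toℕ b + q * + K) - IAP K X Y (+ toℕ b + q * + K + 1ℤ) ≡ IAP K X′ Y′ (+ toℕ b + q * + K)
      conclude b q x′ y′ next X′b Y′b = begin
        - IAP K X Y (+ toℕ b + q * + K) - IAP K X Y (+ toℕ b + q * + K + 1ℤ)
          ≡⟨ cong₂ (λ u v → - u - v) (IAP-eval K X Y b q) next ⟩
        - (X b + q * Y b) - (x′ + q * y′)
          ≡⟨ combine (X b) (Y b) x′ y′ q ⟩
        (- X b - x′) + q * (- Y b - y′)
          ≡⟨ cong₂ (λ x y → x + q * y) X′b Y′b ⟨
        X′ b + q * Y′ b
          ≡⟨ IAP-eval K X′ Y′ b q ⟨
        IAP K X′ Y′ (+ toℕ b + q * + K) ∎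
        where
        open ≡-Reasoning
        combine : ∀ x y x′ y′ q → - (x + q * y) - (x′ + q * y′) ≡ (- x - x′) + q * (- y - y′)
        combine = solve-∀

      step : ∀ b q → - IAP K X Y (+ toℕ b + q * + K) - IAP K X Y (+ toℕ b + q * + K + 1ℤ) ≡
                     IAP K X′ Y′ (+ toℕ b + q * + K)
      step b q with suc (toℕ b) ℕₚ.<? K
      ... | yes 1+b<K =
        let b′ = fromℕ< 1+b<K ; b′≡1+b = Finₚ.toℕ-fromℕ< 1+b<K in
        conclude b q (X b′) (Y b′) (IAP-suc-inner b b′ q b′≡1+b)
                 (proj₁ (inner b b′ b′≡1+b)) (proj₂ (inner b b′ b′≡1+b))
      ... | no 1+b≮K =
        let b≡k = ℕₚ.suc-injective (ℕₚ.≤-antisym (Finₚ.toℕ<n b) (ℕₚ.≮⇒≥ 1+b≮K)) in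
        conclude b q (X zero + Y zero) (Y zero) (IAP-suc-last b q b≡k) (proj₁ (last b b≡k)) (proj₂ (last b b≡k))

  -- Orbits

  orbit-cong : ∀ {u v : Seq} → (∀ j → u j ≡ v j) → ∀ n j → orbit u n j ≡ orbit v n j
  orbit-cong u≗v zero    j = u≗v j
  orbit-cong u≗v (suc n) j = cong₂ (λ x y → - x - y) (orbit-cong u≗v n j) (orbit-cong u≗v n (j + 1ℤ))

  orbit-≡mod-0 : ∀ {m} (u : Seq) → (∀ j → u j ≡ 0ℤ [mod m ]) → ∀ n j → orbit u n j ≡ 0ℤ [mod m ]
  orbit-≡mod-0 u u≡0 zero    j = u≡0 j
  orbit-≡mod-0 {m} u u≡0 (suc n) j = begin
    - orbit u n j - orbit u n (j + 1ℤ)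
      ≈⟨ minus-cong-mod (neg-cong-mod (orbit-≡mod-0 u u≡0 n j)) (orbit-≡mod-0 u u≡0 n (j + 1ℤ)) ⟩
    - 0ℤ - 0ℤ
      ≡⟨⟩
    0ℤ ∎
    where open ≡mod-Reasoning m

  orbit-shift-difference : ∀ (u : Seq) t n j →
                           orbit u (n ℕ.+ t) j - orbit u n j ≡ orbit (λ j → orbit u t j - u j) n j
  orbit-shift-difference u t zero    j = refl
  orbit-shift-difference u t (suc n) j = trans
    (regroup (orbit u (n ℕ.+ t) j) (orbit u (n ℕ.+ t) (j + 1ℤ)) (orbit u n j) (orbit u n (j + 1ℤ)))
    (cong₂ (λ x y → - x - y) (orbit-shift-difference u t n j) (orbit-shift-difference u t n (j + 1ℤ)))
    where
    regroup : ∀ x y x′ y′ → (- x - y) - (- x′ - y′) ≡ - (x - x′) - (y - y′)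
    regroup = solve-∀

  orbit-IAP : ∀ {k} (A D : Tuple (suc k)) n j →
              orbit (IAP (suc k) A D) n j ≡ IAP (suc k) (rowA (suc k) n A D) (rowD (suc k) n D) j
  orbit-IAP A D zero    j = IAP-cong _ (λ s → sym (rowA-0 A D s)) (λ s → sym (rowD-0 D s)) j
  orbit-IAP {k} A D (suc n) j = begin
    - orbit (IAP (suc k) A D) n j - orbit (IAP (suc k) A D) n (j + 1ℤ)
      ≡⟨ cong₂ (λ u v → - u - v) (orbit-IAP A D n j) (orbit-IAP A D n (j + 1ℤ)) ⟩
    - IAP (suc k) (rowA (suc k) n A D) (rowD (suc k) n D) j - IAP (suc k) (rowA (suc k) n A D) (rowD (suc k) n D) (j + 1ℤ)
      ≡⟨ IAP-orbit-step (rowA (suc k) n A D) (rowD (suc k) n D) (rowA (suc k) (suc n) A D) (rowD (suc k) (suc n) D)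
           (λ _ _ b′≡1+b → rowA-step n b′≡1+b A D , rowD-step n b′≡1+b D)
           (λ _ b≡k → rowA-wrap n b≡k A D , rowD-wrap n b≡k D) j ⟩
    IAP (suc k) (rowA (suc k) (suc n) A D) (rowD (suc k) (suc n) D) j ∎
    where open ≡-Reasoning

  module _ {k : ℕ} (A D : Tuple (suc k)) (n : ℕ) (b : Fin (suc k)) where

    private
      K : ℕ
      K = suc k
      u : Seq
      u = orbit (IAP K A D) n
      c : ℤ
      c = + toℕ b

    orbit-IAP-eval₀ : u c ≡ rowA K n A D b
    orbit-IAP-eval₀ = trans (orbit-IAP A D n c) (IAP-eval₀ K (rowA K n A D) (rowD K n D) b)

    orbit-IAP-period : u (c + + K) - u c ≡ rowD K n D b
    orbit-IAP-period = begin
      u (c + + K) - u c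
        ≡⟨ cong₂ _-_ (trans (orbit-IAP A D n (c + + K)) (IAP-eval₁ K (rowA K n A D) (rowD K n D) b))
                     orbit-IAP-eval₀ ⟩
      rowA K n A D b + rowD K n D b - rowA K n A D b
        ≡⟨ cancel (rowA K n A D b) (rowD K n D b) ⟩
      rowD K n D b ∎
      where
      open ≡-Reasoning
      cancel : ∀ x y → x + y - x ≡ y
      cancel = solve-∀

    orbit-IAP-arithmetic : ∀ j → u (c + j * + K) ≡ u c + j * (u (c + + K) - u c)
    orbit-IAP-arithmetic j = begin
      u (c + j * + K)                   ≡⟨ orbit-IAP A D n _ ⟩
      v (c + j * + K)                   ≡⟨ IAP-arithmetic K (rowA K n A D) (rowD K n D) b j ⟩
      v c + j * (v (c + + K) - v c)     ≡⟨ cong₂ (λ x y → x + j * (y - x)) (orbit-IAP A D n c) (orbit-IAP A D n (c + + K)) ⟨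
      u c + j * (u (c + + K) - u c)     ∎
      where
      open ≡-Reasoning
      v : Seq
      v = IAP K (rowA K n A D) (rowD K n D)

  Wmat : (k K : ℕ) → Matrix k k
  Wmat k K = Cmat k K +ₘ (sgn (K ℕ.+ 1) •ₘ Iₘ k)

  ·ᵥ-Wmat : ∀ {k} K (v : Tuple k) s → (v ·ᵥ Wmat k K) s ≡ (v ·ᵥ Cmat k K) s - sgn K * v s
  ·ᵥ-Wmat {k} K v s = begin
    (v ·ᵥ Wmat k K) s
      ≡⟨ ·ᵥ-+ₘ v (Cmat k K) (sgn (K ℕ.+ 1) •ₘ Iₘ k) s ⟩
    (v ·ᵥ Cmat k K) s + (v ·ᵥ (sgn (K ℕ.+ 1) •ₘ Iₘ k)) s
      ≡⟨ cong (_+_ ((v ·ᵥ Cmat k K) s)) (·ᵥ-•ₘ v (sgn (K ℕ.+ 1)) (Iₘ k) s) ⟩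
    (v ·ᵥ Cmat k K) s + sgn (K ℕ.+ 1) * (v ·ᵥ Iₘ k) s
      ≡⟨ cong₂ (λ σ x → (v ·ᵥ Cmat k K) s + σ * x) (sgn-+ K 1) (·ᵥ-Iₘ v s) ⟩
    (v ·ᵥ Cmat k K) s + sgn K * -1ℤ * v s
      ≡⟨ flip-sign ((v ·ᵥ Cmat k K) s) (sgn K) (v s) ⟩
    (v ·ᵥ Cmat k K) s - sgn K * v s ∎
    where
    open ≡-Reasoning
    flip-sign : ∀ c σ x → c + σ * -1ℤ * x ≡ c - σ * x
    flip-sign = solve-∀

  orbit-IAP-difference : ∀ {k} K (X Y : Tuple (suc k)) j →
    orbit (IAP (suc k) X Y) K j - IAP (suc k) X Y j ≡
    IAP (suc k) (sgn K •ᵥ ((X ·ᵥ Wmat (suc k) K) +ᵥ (Y ·ᵥ Tmat (suc k) K))) (sgn K •ᵥ (Y ·ᵥ Wmat (suc k) K)) j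
  orbit-IAP-difference {k} K X Y j = begin
    orbit (IAP (suc k) X Y) K j - IAP (suc k) X Y j
      ≡⟨ cong (_- IAP (suc k) X Y j) (orbit-IAP X Y K j) ⟩
    IAP (suc k) (rowA (suc k) K X Y) (rowD (suc k) K Y) j - IAP (suc k) X Y j
      ≡⟨ IAP-sub (suc k) (rowA (suc k) K X Y) (rowD (suc k) K Y) X Y j ⟩
    IAP (suc k) (λ s → rowA (suc k) K X Y s - X s) (λ s → rowD (suc k) K Y s - Y s) j
      ≡⟨ IAP-cong (suc k) rowA-diff rowD-diff j ⟩
    IAP (suc k) (sgn K •ᵥ ((X ·ᵥ Wmat (suc k) K) +ᵥ (Y ·ᵥ Tmat (suc k) K))) (sgn K •ᵥ (Y ·ᵥ Wmat (suc k) K)) j ∎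
    where
    open ≡-Reasoning
    σ : ℤ
    σ = sgn K

    rowA-diff : ∀ s → rowA (suc k) K X Y s - X s ≡ σ * ((X ·ᵥ Wmat (suc k) K) s + (Y ·ᵥ Tmat (suc k) K) s)
    rowA-diff s = begin
      σ * ((X ·ᵥ Cmat (suc k) K) s + (Y ·ᵥ Tmat (suc k) K) s) - X s
        ≡⟨ sgn-*-sub K _ (X s) ⟩
      σ * ((X ·ᵥ Cmat (suc k) K) s + (Y ·ᵥ Tmat (suc k) K) s - σ * X s)
        ≡⟨ cong (_*_ σ) (swap ((X ·ᵥ Cmat (suc k) K) s) ((Y ·ᵥ Tmat (suc k) K) s) (σ * X s)) ⟩
      σ * ((X ·ᵥ Cmat (suc k) K) s - σ * X s + (Y ·ᵥ Tmat (suc k) K) s)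
        ≡⟨ cong (λ w → σ * (w + (Y ·ᵥ Tmat (suc k) K) s)) (·ᵥ-Wmat K X s) ⟨
      σ * ((X ·ᵥ Wmat (suc k) K) s + (Y ·ᵥ Tmat (suc k) K) s) ∎
      where
      swap : ∀ c t x → c + t - x ≡ c - x + t
      swap = solve-∀

    rowD-diff : ∀ s → rowD (suc k) K Y s - Y s ≡ σ * (Y ·ᵥ Wmat (suc k) K) s
    rowD-diff s = trans (sgn-*-sub K _ (Y s)) (cong (_*_ σ) (sym (·ᵥ-Wmat K Y s)))

  module Interlacing (m : ℕ) {k l : ℕ} (A D : Tuple (suc k)) where

    k₁ k₂ : ℕ
    k₁ = suc k
    k₂ = suc l

    σ : ℤ
    σ = sgn k₂

    W T : Matrix k₁ k₁
    W = Wmat k₁ k₂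
    T = Tmat k₁ k₂

    E F : Tuple k₁
    E = (A ·ᵥ W) +ᵥ (D ·ᵥ T)
    F = D ·ᵥ W

    EW∧F≡0 : Set
    EW∧F≡0 = (∀ s → F s ≡ 0ℤ [mod m ]) × (∀ s → (E ·ᵥ W) s ≡ 0ℤ [mod m ])

    a : Family
    a = orbit (IAP k₁ A D)

    Δ Δ² : Family
    Δ n j = a (n ℕ.+ k₂) j - a n j
    Δ² n j = Δ (n ℕ.+ k₂) j - Δ n j

    Z : Seq
    Z = IAP k₁ (σ •ᵥ E) (σ •ᵥ F)

    Δ≡orbit : ∀ n j → Δ n j ≡ orbit Z n j
    Δ≡orbit n j = trans (orbit-shift-difference (IAP k₁ A D) k₂ n j) (orbit-cong (orbit-IAP-difference k₂ A D) n j)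

    Δ²≡orbit : ∀ n j → Δ² n j ≡ orbit (λ j → orbit Z k₂ j - Z j) n j
    Δ²≡orbit n j = trans (cong₂ _-_ (Δ≡orbit (n ℕ.+ k₂) j) (Δ≡orbit n j)) (orbit-shift-difference Z k₂ n j)

    Δ-period : ∀ n (b : Fin k₁) → Δ n (+ toℕ b + + k₁) - Δ n (+ toℕ b) ≡ rowD k₁ n (σ •ᵥ F) b
    Δ-period n b = trans (cong₂ _-_ (Δ≡orbit n _) (Δ≡orbit n _)) (orbit-IAP-period (σ •ᵥ E) (σ •ᵥ F) n b)

    X₂ Y₂ : Tuple k₁
    X₂ = σ •ᵥ (((σ •ᵥ E) ·ᵥ W) +ᵥ ((σ •ᵥ F) ·ᵥ T))
    Y₂ = σ •ᵥ ((σ •ᵥ F) ·ᵥ W)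

    Δ²-seed : ∀ j → orbit Z k₂ j - Z j ≡ IAP k₁ X₂ Y₂ j
    Δ²-seed = orbit-IAP-difference k₂ (σ •ᵥ E) (σ •ᵥ F)

    σF≡0 : (∀ s → F s ≡ 0ℤ [mod m ]) → ∀ s → (σ •ᵥ F) s ≡ 0ℤ [mod m ]
    σF≡0 F≡0 s = *ˡ-≡mod-0 σ (F≡0 s)

    Δ²≡0 : EW∧F≡0 → ∀ n j → Δ² n j ≡ 0ℤ [mod m ]
    Δ²≡0 (F≡0 , EW≡0) n j = ≡mod-trans (≡⇒≡mod (Δ²≡orbit n j)) (orbit-≡mod-0 _ seed≡0 n j)
      where
      σEW≡0 : ∀ s → ((σ •ᵥ E) ·ᵥ W) s ≡ 0ℤ [mod m ]
      σEW≡0 s = ≡mod-trans (≡⇒≡mod (•ᵥ-·ᵥ σ E W s)) (*ˡ-≡mod-0 σ (EW≡0 s))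
      seed≡0 : ∀ j → orbit Z k₂ j - Z j ≡ 0ℤ [mod m ]
      seed≡0 j = ≡mod-trans (≡⇒≡mod (Δ²-seed j)) (IAP-≡mod-0 k₁ X₂ Y₂
        (λ s → *ˡ-≡mod-0 σ (+-cong-mod (σEW≡0 s) (·ᵥ-≡mod-0 (σ •ᵥ F) T (σF≡0 F≡0) s)))
        (λ s → *ˡ-≡mod-0 σ (·ᵥ-≡mod-0 (σ •ᵥ F) W (σF≡0 F≡0) s)) j)

    Δ-period≡0 : (∀ s → F s ≡ 0ℤ [mod m ]) →
                 ∀ n (b : Fin k₁) → Δ n (+ toℕ b + + k₁) - Δ n (+ toℕ b) ≡ 0ℤ [mod m ]
    Δ-period≡0 F≡0 n b = ≡mod-trans (≡⇒≡mod (Δ-period n b))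
      (*ˡ-≡mod-0 (sgn n) (·ᵥ-≡mod-0 (σ •ᵥ F) (Cmat k₁ n) (σF≡0 F≡0) b))

    private
      +-*-suc : ∀ n i t → n ℕ.+ suc i ℕ.* t ≡ n ℕ.+ i ℕ.* t ℕ.+ t
      +-*-suc = ℕ-Ring.solve-∀

    Δ-stable : EW∧F≡0 → ∀ n i j → Δ (n ℕ.+ i ℕ.* k₂) j ≡ Δ n j [mod m ]
    Δ-stable cond n i j = begin
      Δ (n ℕ.+ i ℕ.* k₂) j       ≈⟨ affine-mod (λ i → Δ (n ℕ.+ i ℕ.* k₂) j) 0ℤ step i ⟩
      Δ (n ℕ.+ 0) j + + i * 0ℤ   ≡⟨ cong₂ (λ t x → Δ t j + x) (ℕₚ.+-identityʳ n) (ℤₚ.*-zeroʳ (+ i)) ⟩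
      Δ n j + 0ℤ                 ≡⟨ ℤₚ.+-identityʳ (Δ n j) ⟩
      Δ n j                      ∎
      where
      open ≡mod-Reasoning m
      step : ∀ i → Δ (n ℕ.+ suc i ℕ.* k₂) j - Δ (n ℕ.+ i ℕ.* k₂) j ≡ 0ℤ [mod m ]
      step i = ≡mod-trans (≡⇒≡mod (cong (λ t → Δ t j - Δ (n ℕ.+ i ℕ.* k₂) j) (+-*-suc n i k₂)))
                          (Δ²≡0 cond (n ℕ.+ i ℕ.* k₂) j)

    a-affine : EW∧F≡0 → ∀ n i j → a (n ℕ.+ i ℕ.* k₂) j ≡ a n j + + i * Δ n j [mod m ]
    a-affine cond n i j = begin
      a (n ℕ.+ i ℕ.* k₂) j          ≈⟨ affine-mod (λ i → a (n ℕ.+ i ℕ.* k₂) j) (Δ n j) step i ⟩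
      a (n ℕ.+ 0) j + + i * Δ n j   ≡⟨ cong (λ t → a t j + + i * Δ n j) (ℕₚ.+-identityʳ n) ⟩
      a n j + + i * Δ n j           ∎
      where
      open ≡mod-Reasoning m
      step : ∀ i → a (n ℕ.+ suc i ℕ.* k₂) j - a (n ℕ.+ i ℕ.* k₂) j ≡ Δ n j [mod m ]
      step i = ≡mod-trans (≡⇒≡mod (cong (λ t → a t j - a (n ℕ.+ i ℕ.* k₂) j) (+-*-suc n i k₂)))
                          (Δ-stable cond n i j)

    EW∧F≡0⇒interlaced : EW∧F≡0 → InterlacedDA m k₁ k₂ a
    EW∧F≡0⇒interlaced cond i₀ j₀ i j = ≡mod⇒≡[] (≡mod-trans
      (≡⇒≡mod (orbit-IAP-arithmetic A D (n ℕ.+ i ℕ.* k₂) j₀ j))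
      (bilinear-mod (+ i) j (a n c) (a n (c + + k₁)) (Δ n c) (Δ n (c + + k₁))
                    (a-affine cond n i c) (a-affine cond n i (c + + k₁)) (Δ-period≡0 (proj₁ cond) n j₀)))
      where
      n : ℕ
      n = toℕ i₀
      c : ℤ
      c = + toℕ j₀

    first-column : InterlacedDA m k₁ k₂ a → ∀ (s : Fin k₁) i j → let c = + toℕ s in
                   a (i ℕ.* k₂) (c + j * + k₁) ≡ a 0 c + + i * Δ 0 c + j * (a 0 (c + + k₁) - a 0 c) [mod m ]
    first-column I s i j = ≡[]⇒≡mod (I zero s i j)

    interlaced⇒F≡0 : InterlacedDA m k₁ k₂ a → ∀ s → F s ≡ 0ℤ [mod m ]
    interlaced⇒F≡0 I s = sgn-*-≡mod-0 k₂ (begin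
      σ * F s                                  ≡⟨ rowD-0 (σ •ᵥ F) s ⟨
      rowD k₁ 0 (σ •ᵥ F) s                     ≡⟨ Δ-period 0 s ⟨
      Δ 0 (c + + k₁) - Δ 0 c                   ≡⟨ regroup (a k₂ (c + + k₁)) (a 0 (c + + k₁)) (a k₂ c) (a 0 c) ⟩
      a k₂ (c + + k₁) - rhs
        ≡⟨ cong₂ (λ t x → a t (c + x) - rhs) (ℕₚ.+-identityʳ k₂) (ℤₚ.*-identityˡ (+ k₁)) ⟨
      a (1 ℕ.* k₂) (c + 1ℤ * + k₁) - rhs       ≈⟨ minus-congʳ-mod rhs (first-column I s 1 1ℤ) ⟩
      rhs - rhs                                ≡⟨ ℤₚ.+-inverseʳ rhs ⟩
      0ℤ                                       ∎)
      where
      open ≡mod-Reasoning m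
      c rhs : ℤ
      c = + toℕ s
      rhs = a 0 c + + 1 * Δ 0 c + 1ℤ * (a 0 (c + + k₁) - a 0 c)
      regroup : ∀ x y z w → (x - y) - (z - w) ≡ x - (w + + 1 * (z - w) + 1ℤ * (y - w))
      regroup = solve-∀

    interlaced⇒EW≡0 : InterlacedDA m k₁ k₂ a → ∀ s → (E ·ᵥ W) s ≡ 0ℤ [mod m ]
    interlaced⇒EW≡0 I s = sgn-*-≡mod-0 k₂
      (≡mod-trans (≡⇒≡mod (sym (•ᵥ-·ᵥ σ E W s))) (+-≡mod-0-cancelʳ σEW+σFT≡0 σFT≡0))
      where
      open ≡mod-Reasoning m
      c rhs : ℤ
      c = + toℕ s
      rhs = a 0 c + + 2 * Δ 0 c + 0ℤ * (a 0 (c + + k₁) - a 0 c)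
      regroup : ∀ x z w q → (x - z) - (z - w) ≡ x - (w + + 2 * (z - w) + 0ℤ * q)
      regroup = solve-∀

      σFT≡0 : ((σ •ᵥ F) ·ᵥ T) s ≡ 0ℤ [mod m ]
      σFT≡0 = ·ᵥ-≡mod-0 (σ •ᵥ F) T (σF≡0 (interlaced⇒F≡0 I)) s

      σEW+σFT≡0 : ((σ •ᵥ E) ·ᵥ W) s + ((σ •ᵥ F) ·ᵥ T) s ≡ 0ℤ [mod m ]
      σEW+σFT≡0 = sgn-*-≡mod-0 k₂ (begin
        σ * (((σ •ᵥ E) ·ᵥ W) s + ((σ •ᵥ F) ·ᵥ T) s)  ≡⟨ IAP-eval₀ k₁ X₂ Y₂ s ⟨
        _                                           ≡⟨ Δ²-seed c ⟨
        orbit Z k₂ c - Z c                          ≡⟨ Δ²≡orbit 0 c ⟨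
        Δ² 0 c
          ≡⟨ regroup (a (k₂ ℕ.+ k₂) c) (a k₂ c) (a 0 c) (a 0 (c + + k₁) - a 0 c) ⟩
        a (k₂ ℕ.+ k₂) c - rhs
          ≡⟨ cong₂ (λ t x → a (k₂ ℕ.+ t) x - rhs) (ℕₚ.+-identityʳ k₂) (ℤₚ.+-identityʳ c) ⟨
        a (2 ℕ.* k₂) (c + 0ℤ * + k₁) - rhs          ≈⟨ minus-congʳ-mod rhs (first-column I s 2 0ℤ) ⟩
        rhs - rhs                                   ≡⟨ ℤₚ.+-inverseʳ rhs ⟩
        0ℤ                                          ∎)

    interlaced⇔EW∧F≡0 : InterlacedDA m k₁ k₂ a ⇔ EW∧F≡0
    interlaced⇔EW∧F≡0 = mk⇔ (λ I → interlaced⇒F≡0 I , interlaced⇒EW≡0 I) EW∧F≡0⇒interlaced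

    𝐀 𝐃₁ 𝐃₂ : Fin k₂ → Tuple k₁
    𝐀 i = rowA k₁ (toℕ i) A D
    𝐃₁ i = rowD k₁ (toℕ i) D
    𝐃₂ i = sgn (toℕ i ℕ.+ k₂) •ᵥ (E ·ᵥ Cmat k₁ (toℕ i))

    Δ≡𝐃₂ : (∀ s → F s ≡ 0ℤ [mod m ]) →
           ∀ (i₀ : Fin k₂) (b : Fin k₁) → Δ (toℕ i₀) (+ toℕ b) ≡ 𝐃₂ i₀ b [mod m ]
    Δ≡𝐃₂ F≡0 i₀ b = begin
      Δ n (+ toℕ b)
        ≡⟨ trans (Δ≡orbit n _) (orbit-IAP-eval₀ (σ •ᵥ E) (σ •ᵥ F) n b) ⟩
      sgn n * (((σ •ᵥ E) ·ᵥ Cₙ) b + ((σ •ᵥ F) ·ᵥ Tmat k₁ n) b)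
        ≈⟨ *-congˡ-mod (sgn n) (+-congˡ-mod (((σ •ᵥ E) ·ᵥ Cₙ) b)
                                            (·ᵥ-≡mod-0 (σ •ᵥ F) (Tmat k₁ n) (σF≡0 F≡0) b)) ⟩
      sgn n * (((σ •ᵥ E) ·ᵥ Cₙ) b + 0ℤ)
        ≡⟨ cong (_*_ (sgn n)) (trans (ℤₚ.+-identityʳ _) (•ᵥ-·ᵥ σ E Cₙ b)) ⟩
      sgn n * (σ * (E ·ᵥ Cₙ) b)
        ≡⟨ ℤₚ.*-assoc (sgn n) σ ((E ·ᵥ Cₙ) b) ⟨
      sgn n * σ * (E ·ᵥ Cₙ) b
        ≡⟨ cong (_* (E ·ᵥ Cₙ) b) (sgn-+ n k₂) ⟨
      sgn (n ℕ.+ k₂) * (E ·ᵥ Cₙ) b ∎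
      where
      open ≡mod-Reasoning m
      n : ℕ
      n = toℕ i₀
      Cₙ : Matrix k₁ k₁
      Cₙ = Cmat k₁ n

    orbit≈IDAP : InterlacedDA m k₁ k₂ a → a ≈F[ m ] IDAP k₁ k₂ 𝐀 𝐃₁ 𝐃₂
    orbit≈IDAP I i j = ≡mod⇒≡[] (begin
      a i j
        ≡⟨ cong₂ a i≡ (residue-quotient k₁ j) ⟩
      a (n ℕ.+ iq ℕ.* k₂) (c + jq * + k₁)
        ≈⟨ ≡[]⇒≡mod (I i₀ j₀ iq jq) ⟩
      a n c + + iq * Δ n c + jq * (a n (c + + k₁) - a n c)
        ≈⟨ +-cong-mod (+-cong-mod (≡⇒≡mod (orbit-IAP-eval₀ A D n j₀))
                                  (*-congˡ-mod (+ iq) (Δ≡𝐃₂ (interlaced⇒F≡0 I) i₀ j₀)))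
                      (≡⇒≡mod (cong (_*_ jq) (orbit-IAP-period A D n j₀))) ⟩
      𝐀 i₀ j₀ + + iq * 𝐃₂ i₀ j₀ + jq * 𝐃₁ i₀ j₀
        ∎)
      where
      open ≡mod-Reasoning m
      i₀ : Fin k₂
      i₀ = fromℕ< (ℕₚ.m%n<n i k₂)
      iq n : ℕ
      iq = i ℕ./ k₂
      n = toℕ i₀
      j₀ : Fin k₁
      j₀ = residue k₁ j
      jq c : ℤ
      jq = j /ℕ k₁
      c = + toℕ j₀
      i≡ : i ≡ n ℕ.+ iq ℕ.* k₂
      i≡ = trans (ℕₚ.m≡m%n+[m/n]*n i k₂) (cong (ℕ._+ iq ℕ.* k₂) (sym (Finₚ.toℕ-fromℕ< (ℕₚ.m%n<n i k₂))))

    V : Tuple (k₁ ℕ.+ k₁)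
    V = (A ++ D) ·ᵥ block (W ·ₘ W) (0ₘ k₁ k₁) (T ·ₘ W) W

    V-↑ˡ : ∀ s → V (s ↑ˡ k₁) ≡ (E ·ᵥ W) s
    V-↑ˡ s = begin
      V (s ↑ˡ k₁)                           ≡⟨ ++-·ᵥ-block-↑ˡ A D (W ·ₘ W) (0ₘ k₁ k₁) (T ·ₘ W) W s ⟩
      (A ·ᵥ (W ·ₘ W)) s + (D ·ᵥ (T ·ₘ W)) s ≡⟨ cong₂ _+_ (·ᵥ-·ₘ A W W s) (·ᵥ-·ₘ D T W s) ⟩
      ((A ·ᵥ W) ·ᵥ W) s + ((D ·ᵥ T) ·ᵥ W) s ≡⟨ +ᵥ-·ᵥ (A ·ᵥ W) (D ·ᵥ T) W s ⟨
      (E ·ᵥ W) s                            ∎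
      where open ≡-Reasoning

    V-↑ʳ : ∀ s → V (k₁ ↑ʳ s) ≡ F s
    V-↑ʳ s = begin
      V (k₁ ↑ʳ s)                           ≡⟨ ++-·ᵥ-block-↑ʳ A D (W ·ₘ W) (0ₘ k₁ k₁) (T ·ₘ W) W s ⟩
      (A ·ᵥ 0ₘ k₁ k₁) s + F s               ≡⟨ cong (_+ F s) (·ᵥ-zero-column A (0ₘ k₁ k₁) s (λ _ → refl)) ⟩
      0ℤ + F s                              ≡⟨ ℤₚ.+-identityˡ (F s) ⟩
      F s                                   ∎
      where open ≡-Reasoning

    block≡0⇔EW∧F≡0 : V ≋[ m ] (λ _ → 0ℤ) ⇔ EW∧F≡0
    block≡0⇔EW∧F≡0 = mk⇔
      (λ V≡0 → (λ s → ≡mod-trans (≡⇒≡mod (sym (V-↑ʳ s))) (≡[]⇒≡mod (V≡0 (k₁ ↑ʳ s))))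
             , (λ s → ≡mod-trans (≡⇒≡mod (sym (V-↑ˡ s))) (≡[]⇒≡mod (V≡0 (s ↑ˡ k₁)))))
      (λ (F≡0 , EW≡0) → ↑-induction (λ t → V t ≡[ m ] 0ℤ)
        (λ s → ≡mod⇒≡[] (≡mod-trans (≡⇒≡mod (V-↑ˡ s)) (EW≡0 s)))
        (λ s → ≡mod⇒≡[] (≡mod-trans (≡⇒≡mod (V-↑ʳ s)) (F≡0 s))))

open OrbitOfIAP using (module Interlacing)
open import Data.Nat.Base using (ℕ; NonZero; zero; suc; _+_)
open import Data.Integer.Base using (0ℤ)
open import Data.Fin.Base using (toℕ)
open import Data.Product.Base using (_×_; _,_)
open import Data.Vec.Functional using (_++_)
open import Function.Bundles using (_⇔_)
open import Function.Construct.Composition using (_⇔-∘_)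
open import Function.Construct.Symmetry using (⇔-sym)

theorem11 : (m k₁ k₂ : ℕ) .{{_ : NonZero k₁}} .{{_ : NonZero k₂}}
    → (A D : Tuple k₁)
    → let W = Cmat k₁ k₂ +ₘ (sgn (k₂ + 1) •ₘ Iₘ k₁)
          T = Tmat k₁ k₂
          S = IAP k₁ A D
          𝐀 = λ i → sgn (toℕ i) •ᵥ ((A ·ᵥ Cmat k₁ (toℕ i)) +ᵥ (D ·ᵥ Tmat k₁ (toℕ i)))
          𝐃₁ = λ i → sgn (toℕ i) •ᵥ (D ·ᵥ Cmat k₁ (toℕ i))
          𝐃₂ = λ i → sgn (toℕ i + k₂) •ᵥ (((A ·ᵥ W) +ᵥ (D ·ᵥ T)) ·ᵥ Cmat k₁ (toℕ i))
      in (InterlacedDA m k₁ k₂ (orbit S)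
            ⇔ ((A ++ D) ·ᵥ block (W ·ₘ W) (0ₘ k₁ k₁) (T ·ₘ W) W) ≋[ m ] (λ _ → 0ℤ))
         × (InterlacedDA m k₁ k₂ (orbit S) → orbit S ≈F[ m ] IDAP k₁ k₂ 𝐀 𝐃₁ 𝐃₂)
theorem11 m zero    k₂      {{()}} A D
theorem11 m (suc k) zero    {{_}} {{()}} A D
theorem11 m (suc k) (suc l) A D = ⇔-sym block≡0⇔EW∧F≡0 ⇔-∘ interlaced⇔EW∧F≡0 , orbit≈IDAP
  where open Interlacing m A D
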